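{- Let $n\ge 1$ and let all Greek letters below denote multiplicative characters of $\mathbb{F}_q$. (i) For all $\alpha,\beta_i,\gamma_i$ and all $\lambda_1,\dots,\lambda_n\in\mathbb{F}_q$, $$-g(\alpha)\,F_A^{(n)}(\alpha;\beta_1,\dots,\beta_n;\gamma_1,\dots,\gamma_n;\lambda_1,\dots,\lambda_n)=\sum_{t\in\mathbb{F}_q^\times}\psi(t)\alpha(t)\prod_{i=1}^n {}_1F_1(\beta_i;\gamma_i;\lambda_i t).$$ (ii) For all $\alpha_i,\beta_i,\gamma$ and all $\lambda_i\in\mathbb{F}_q$, $$-\frac{q}{g^\circ(\gamma)}\,F_B^{(n)}(\alpha_1,\dots,\alpha_n;\beta_1,\dots,\beta_n;\gamma;\lambda_1,\dots,\lambda_n)=\sum_{t\in\mathbb{F}_q^\times}\psi(-t)\overline{\gamma}(t)\prod_{i=1}^n {}_2F_0\Big(\alpha_i,\beta_i;\,;\frac{\lambda_i}{t}\Big).$$ (iii) Suppose $p\neq 2$. For all $\alpha,\beta_i$ and all $\lambda_i\in\mathbb{F}_q$, $$-g(\alpha^2)\,F_C^{(n)}(\alpha;\alpha\phi;\beta_1,\dots,\beta_n;\lambda_1,\dots,\lambda_n)=\sum_{t\in\mathbb{F}_q^\times}\psi(t)\alpha^2(t)\prod_{i=1}^n {}_0F_1\Big(\,;\beta_i;\frac{\lambda_i t^2}{4}\Big).$$ (iv) For all $\alpha,\beta,\gamma_i$ and all $\lambda_i\in\mathbb{F}_q$, $$g(\alpha)g(\beta)\,F_C^{(n)}(\alpha;\beta;\gamma_1,\dots,\gamma_n;\lambda_1,\dots,\lambda_n)=\sum_{s,t\in\mathbb{F}_q^\times}\psi(s+t)\alpha(s)\beta(t)\prod_{i=1}^n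 {}_0F_1(\,;\gamma_i;\lambda_i st).$$
   Context: Let $\mathbb{F}_q$ be a finite field with $q$ elements and characteristic $p$. Let $\widehat{\mathbb{F}_q^\times}=\mathrm{Hom}(\mathbb{F}_q^\times,\overline{\mathbb{Q}}^\times)$ be the group of multiplicative characters; $\varepsilon$ is the trivial character and, when $p\neq2$, $\phi$ is the quadratic character. Every character $\eta$ (including $\varepsilon$) is extended by $\eta(0)=0$; $\overline{\eta}=\eta^{ -1}$; products of characters are pointwise (so e.g. $\alpha^2(t)=\alpha(t)^2$). Put $\delta(\eta)=1$ if $\eta=\varepsilon$ and $0$ otherwise. Fix a nontrivial additive character $\psi$ of $\mathbb{F}_q$. Gauss sums: $g(\eta)=-\sum_{x\in\mathbb{F}_q^\times}\psi(x)\eta(x)$, $g^\circ(\eta)=q^{\delta(\eta)}g(\eta)$. For characters $\alpha,\nu$: $(\alpha)_\nu=g(\alpha\nu)/g(\alpha)$, $(\alpha)^\circ_\nu=g^\circ(\alpha\nu)/g^\circ(\alpha)$. For characters $\alpha_1,\dots,\alpha_m,\beta_1,\dots,\beta_k$ ($m,k\ge0$) and $\lambda\in\mathbb{F}_q$, $${}_mF_k(\alpha_1,\dots,\alpha_m;\beta_1,\dots,\beta_k;\lambda)=\frac{1}{1-q}\sum_{\nu\in\widehat{\mathbb{F}_q^\times}}\frac{(\alpha_1)_\nu\cdots(\alpha_m)_\nu}{(\varepsilon)^\circ_\nu(\beta_1)^\circ_\nu\cdots(\beta_k)^\circ_\nu}\nu(\lambda)$$ (an empty list of parameters is written as blank).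 Lauricella functions: for $\lambda_i\in\mathbb{F}_q$, with sums over all $(\nu_1,\dots,\nu_n)\in(\widehat{\mathbb{F}_q^\times})^n$ and $\Lambda=\prod_{i=1}^n\nu_i(\lambda_i)$, $E=\prod_{i=1}^n(\varepsilon)^\circ_{\nu_i}$: $F_A^{(n)}(\alpha;\beta_1,\dots,\beta_n;\gamma_1,\dots,\gamma_n;\lambda_1,\dots,\lambda_n)=\frac{1}{(1-q)^n}\sum\frac{(\alpha)_{\nu_1\cdots\nu_n}\prod_i(\beta_i)_{\nu_i}}{\prod_i(\gamma_i)^\circ_{\nu_i}\,E}\Lambda$; $F_B^{(n)}(\alpha_1,\dots,\alpha_n;\beta_1,\dots,\beta_n;\gamma;\lambda_1,\dots,\lambda_n)=\frac{1}{(1-q)^n}\sum\frac{\prod_i(\alpha_i)_{\nu_i}(\beta_i)_{\nu_i}}{(\gamma)^\circ_{\nu_1\cdots\nu_n}\,E}\Lambda$; $F_C^{(n)}(\alpha;\beta;\gamma_1,\dots,\gamma_n;\lambda_1,\dots,\lambda_n)=\frac{1}{(1-q)^n}\sum\frac{(\alpha)_{\nu_1\cdots\nu_n}(\beta)_{\nu_1\cdots\nu_n}}{\prod_i(\gamma_i)^\circ_{\nu_i}\,E}\Lambda$. -}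

module Defs where

open import Data.Nat as ℕ using (ℕ; zero; suc)
open import Data.Nat.Primality using (Prime)
open import Data.Fin using (Fin; zero; suc)
open import Data.List using (List; []; _∷_; foldr; filter; length)
open import Data.List.Membership.Propositional using (_∈_)
open import Data.List.Relation.Unary.Unique.Propositional using (Unique)
open import Data.List.Relation.Unary.All using (All; all?)
open import Data.List.Relation.Unary.Any using (Any; any?)
open import Data.List.Relation.Unary.AllPairs using (AllPairs)
open import Data.Product using (Σ; ∃; _×_; _,_)
open import Relation.Nullary using (¬_; Dec; yes; no; does; ¬?)
open import Relation.Binary.PropositionalEquality using (_≡_; _≢_)
open import Relation.Binary.Definitions using (DecidableEquality)
open import Algebra.Core using (Op₁; Op₂)
open import Algebra.Structures using (IsCommutativeRing)
open import Data.Bool using (if_then_else_)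

-- Fields (equality is propositional equality; the inverse is a total
-- function whose value at 0 is unspecified and never used).

record Field : Set₁ where
  infixl 7 _*_
  infixl 6 _+_
  field
    Carrier : Set
    _+_ _*_ : Op₂ Carrier
    -_ : Op₁ Carrier
    0# 1# : Carrier
    _⁻¹ : Op₁ Carrier
    isCommutativeRing : IsCommutativeRing _≡_ _+_ _*_ -_ 0# 1#
    0≢1 : 0# ≢ 1#
    ⁻¹-inverse : ∀ x → x ≢ 0# → x * (x ⁻¹) ≡ 1#
    _≟_ : DecidableEquality Carrier

  fromℕ : ℕ → Carrier
  fromℕ zero = 0#
  fromℕ (suc n) = 1# + fromℕ n

  _^_ : Carrier → ℕ → Carrier
  x ^ zero = 1#
  x ^ suc n = x * (x ^ n)

  _-_ : Op₂ Carrier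
  x - y = x + (- y)

  sumL : {A : Set} → List A → (A → Carrier) → Carrier
  sumL xs f = foldr (λ a r → f a + r) 0# xs

  prodL : {A : Set} → List A → (A → Carrier) → Carrier
  prodL xs f = foldr (λ a r → f a * r) 1# xs

  prodFin : (n : ℕ) → (Fin n → Carrier) → Carrier
  prodFin zero f = 1#
  prodFin (suc n) f = f zero * prodFin n (λ i → f (suc i))

  sumFin : (n : ℕ) → (Fin n → Carrier) → Carrier
  sumFin zero f = 0#
  sumFin (suc n) f = f zero + sumFin n (λ i → f (suc i))

CharZero : Field → Set
CharZero K = ∀ n → Field.fromℕ K (suc n) ≢ Field.0# K

AlgClosed : Field → Set
AlgClosed K = ∀ (n : ℕ) (c : Fin (suc n) → Carrier) →
  ∃ λ x → (x ^ suc n) + sumFin (suc n) (λ i → c i * (x ^ Data.Fin.toℕ i)) ≡ 0#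
  where open Field K

record FiniteField : Set₁ where
  field
    field' : Field
  open Field field' public
  field
    elements : List Carrier
    complete : ∀ x → x ∈ elements
    unique : Unique elements

  q : ℕ
  q = length elements

  units : List Carrier
  units = filter (λ x → ¬? (x ≟ 0#)) elements

HasCharacteristic : FiniteField → ℕ → Set
HasCharacteristic F p = Prime p × (FiniteField.fromℕ F p ≡ FiniteField.0# F)

module Characters (F : FiniteField) (K : Field) where
  private
    module F = FiniteField F
    module K = Field K

  Ch : Set
  Ch = F.Carrier → K.Carrier

  -- multiplicative character of F_q^×, extended by η(0) = 0
  record IsMultChar (η : Ch) : Set where
    field
      at-0 : η F.0# ≡ K.0#
      at-1 : η F.1# ≡ K.1#
      hom : ∀ x y → η (x F.* y) ≡ η x K.* η y

  record IsNontrivAddChar (ψ : Ch) : Set where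
    field
      hom : ∀ x y → ψ (x F.+ y) ≡ ψ x K.* ψ y
      nontrivial : ∃ λ x → ψ x ≢ K.1#

  record IsCharList (chars : List Ch) : Set where
    field
      all-chars : All IsMultChar chars
      complete : ∀ η → IsMultChar η → Any (λ χ → ∀ x → η x ≡ χ x) chars
      distinct : AllPairs (λ χ χ′ → ¬ (∀ x → χ x ≡ χ′ x)) chars

module Hyper (F : FiniteField) (K : Field) (ψ : FiniteField.Carrier F → Field.Carrier K)
             (chars : List (FiniteField.Carrier F → Field.Carrier K)) where
  private
    module F = FiniteField F
  open Field K
  open Characters F K public using (Ch)

  qK : Carrier
  qK = fromℕ F.q

  sumUnits : (F.Carrier → Carrier) → Carrier
  sumUnits f = sumL F.units f

  ε : Ch
  ε x = if does (x F.≟ F.0#) then 0# else 1#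

  φ : Ch
  φ x = if does (x F.≟ F.0#) then 0#
        else (if does (any? (λ y → (y F.* y) F.≟ x) F.elements) then 1# else - 1#)

  _·_ : Ch → Ch → Ch
  (α · β) x = α x * β x

  conj : Ch → Ch
  conj η x = if does (x F.≟ F.0#) then 0# else (η x) ⁻¹

  prodCh : (n : ℕ) → (Fin n → Ch) → Ch
  prodCh n ν x = prodFin n (λ i → ν i x)

  δ : Ch → ℕ
  δ η = if does (all? (λ x → η x ≟ ε x) F.elements) then 1 else 0

  g : Ch → Carrier
  g η = - sumUnits (λ x → ψ x * η x)

  g° : Ch → Carrier
  g° η = (qK ^ δ η) * g η

  poch : Ch → Ch → Carrier
  poch α ν = g (α · ν) * (g α) ⁻¹

  poch° : Ch → Ch → Carrier
  poch° α ν = g° (α · ν) * (g° α) ⁻¹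

  sumTuples : (n : ℕ) → ((Fin n → Ch) → Carrier) → Carrier
  sumTuples zero f = f (λ ())
  sumTuples (suc n) f =
    sumL chars (λ ν → sumTuples n (λ νs → f (λ { zero → ν ; (suc i) → νs i })))

  hypF : List Ch → List Ch → F.Carrier → Carrier
  hypF as bs l = (1# - qK) ⁻¹ *
    sumL chars (λ ν → prodL as (λ a → poch a ν)
                      * (poch° ε ν * prodL bs (λ b → poch° b ν)) ⁻¹
                      * ν l)

  E : (n : ℕ) → (Fin n → Ch) → Carrier
  E n ν = prodFin n (λ i → poch° ε (ν i))

  Λ : (n : ℕ) → (Fin n → Ch) → (Fin n → F.Carrier) → Carrier
  Λ n ν ls = prodFin n (λ i → ν i (ls i))

  FA : (n : ℕ) → Ch → (Fin n → Ch) → (Fin n → Ch) → (Fin n → F.Carrier) → Carrier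
  FA n α β γ ls = ((1# - qK) ^ n) ⁻¹ *
    sumTuples n (λ ν → poch α (prodCh n ν) * prodFin n (λ i → poch (β i) (ν i))
                       * (prodFin n (λ i → poch° (γ i) (ν i)) * E n ν) ⁻¹
                       * Λ n ν ls)

  FB : (n : ℕ) → (Fin n → Ch) → (Fin n → Ch) → Ch → (Fin n → F.Carrier) → Carrier
  FB n α β γ ls = ((1# - qK) ^ n) ⁻¹ *
    sumTuples n (λ ν → prodFin n (λ i → poch (α i) (ν i) * poch (β i) (ν i))
                       * (poch° γ (prodCh n ν) * E n ν) ⁻¹
                       * Λ n ν ls)

  FC : (n : ℕ) → Ch → Ch → (Fin n → Ch) → (Fin n → F.Carrier) → Carrier
  FC n α β γ ls = ((1# - qK) ^ n) ⁻¹ *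
    sumTuples n (λ ν → poch α (prodCh n ν) * poch β (prodCh n ν)
                       * (prodFin n (λ i → poch° (γ i) (ν i)) * E n ν) ⁻¹
                       * Λ n ν ls)

{-# OPTIONS --safe #-}
module Submission where

-- Expanding each product of hypergeometric functions on the right as a sum over tuples ν of
-- characters and exchanging the sums, the sum over t becomes a Gauss sum g(α ν₁ ⋯ νₙ) (in (ii) the
-- conjugate sum Σ ψ(-t) η̄(t) = -q / g°(η), in (iv) a product of two Gauss sums), and the relation
-- (α)_ν = g(αν) / g(α) identifies the result with the ν-th term of the Lauricella series.  Part (iii)
-- needs in addition the duplication formula g(χ) g(χφ) = χ(1/4) g(χ²) g(φ), proved with Jacobi sums.
-- If ψ(0) = 0 then ψ vanishes identically and both sides are 0 (for (ii) this uses n ≥ 1).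

open import Defs
open import Data.Nat using (ℕ; _≤_)
open import Data.Fin using (Fin)
open import Data.List using (List; []; _∷_)
open import Data.Product using (_×_)
open import Relation.Binary.PropositionalEquality using (_≡_; _≢_)
open import Algebra.Bundles using (CommutativeRing)

-- The ring solver with integer coefficients, valid in every commutative ring (the natural-number
-- instance of the library cannot handle negation).
module IntegerSolver {c ℓ} (R : CommutativeRing c ℓ) where

  open import Data.Nat as ℕ using (ℕ; zero; suc)
  open import Data.Integer as ℤ using (ℤ; +_; -[1+_]; _⊖_)
  import Data.Integer.Properties as ℤ
  open import Data.Sign as Sign using (Sign)
  open import Data.Maybe using (Maybe; just; nothing)
  open import Relation.Nullary using (yes; no)
  import Relation.Binary.PropositionalEquality as ≡
  open import Algebra.Solver.Ring.AlmostCommutativeRing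
  open CommutativeRing R
  open import Algebra.Properties.Ring ring using (-0#≈0#; -‿involutive; -‿distribʳ-*; -1*x≈-x; -‿+-comm)
  open import Relation.Binary.Reasoning.Setoid setoid

  fromℕ : ℕ → Carrier
  fromℕ zero    = 0#
  fromℕ (suc n) = 1# + fromℕ n

  fromℕ-+ : ∀ m n → fromℕ (m ℕ.+ n) ≈ fromℕ m + fromℕ n
  fromℕ-+ zero    n = sym (+-identityˡ _)
  fromℕ-+ (suc m) n = trans (+-congˡ (fromℕ-+ m n)) (sym (+-assoc _ _ _))

  fromℕ-* : ∀ m n → fromℕ (m ℕ.* n) ≈ fromℕ m * fromℕ n
  fromℕ-* zero    n = sym (zeroˡ _)
  fromℕ-* (suc m) n = begin
    fromℕ (n ℕ.+ m ℕ.* n)             ≈⟨ fromℕ-+ n (m ℕ.* n) ⟩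
    fromℕ n + fromℕ (m ℕ.* n)         ≈⟨ +-cong (sym (*-identityˡ _)) (fromℕ-* m n) ⟩
    1# * fromℕ n + fromℕ m * fromℕ n  ≈⟨ sym (distribʳ _ _ _) ⟩
    (1# + fromℕ m) * fromℕ n          ∎

  fromℤ : ℤ → Carrier
  fromℤ (+ n)    = fromℕ n
  fromℤ -[1+ n ] = - fromℕ (suc n)

  [1+a]-[1+b]≈a-b : ∀ a b → (1# + a) + - (1# + b) ≈ a + - b
  [1+a]-[1+b]≈a-b a b = begin
    (1# + a) + - (1# + b)    ≈⟨ +-congˡ (sym (-‿+-comm 1# b)) ⟩
    (1# + a) + (- 1# + - b)  ≈⟨ +-assoc _ _ _ ⟩
    1# + (a + (- 1# + - b))  ≈⟨ +-congˡ (sym (+-assoc _ _ _)) ⟩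
    1# + ((a + - 1#) + - b)  ≈⟨ +-congˡ (+-congʳ (+-comm _ _)) ⟩
    1# + ((- 1# + a) + - b)  ≈⟨ +-congˡ (+-assoc _ _ _) ⟩
    1# + (- 1# + (a + - b))  ≈⟨ sym (+-assoc _ _ _) ⟩
    (1# + - 1#) + (a + - b)  ≈⟨ +-congʳ (-‿inverseʳ 1#) ⟩
    0# + (a + - b)           ≈⟨ +-identityˡ _ ⟩
    a + - b                  ∎

  fromℤ-⊖ : ∀ m n → fromℤ (m ⊖ n) ≈ fromℕ m + - fromℕ n
  fromℤ-⊖ zero    zero    = sym (trans (+-identityˡ _) -0#≈0#)
  fromℤ-⊖ (suc m) zero    = sym (trans (+-congˡ -0#≈0#) (+-identityʳ _))
  fromℤ-⊖ zero    (suc n) = sym (+-identityˡ _)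
  fromℤ-⊖ (suc m) (suc n) = begin
    fromℤ (suc m ⊖ suc n)            ≡⟨ ≡.cong fromℤ (ℤ.[1+m]⊖[1+n]≡m⊖n m n) ⟩
    fromℤ (m ⊖ n)                    ≈⟨ fromℤ-⊖ m n ⟩
    fromℕ m + - fromℕ n              ≈⟨ sym ([1+a]-[1+b]≈a-b _ _) ⟩
    fromℕ (suc m) + - fromℕ (suc n)  ∎

  fromℤ-+ : ∀ i j → fromℤ (i ℤ.+ j) ≈ fromℤ i + fromℤ j
  fromℤ-+ (+ m)    (+ n)    = fromℕ-+ m n
  fromℤ-+ (+ m)    -[1+ n ] = fromℤ-⊖ m (suc n)
  fromℤ-+ -[1+ m ] (+ n)    = trans (fromℤ-⊖ n (suc m)) (+-comm _ _)
  fromℤ-+ -[1+ m ] -[1+ n ] = begin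
    - fromℕ (suc (suc (m ℕ.+ n)))       ≡⟨ ≡.cong (λ k → - fromℕ (suc k)) (≡.sym (ℕ.+-suc m n)) ⟩
    - fromℕ (suc m ℕ.+ suc n)           ≈⟨ -‿cong (fromℕ-+ (suc m) (suc n)) ⟩
    - (fromℕ (suc m) + fromℕ (suc n))   ≈⟨ sym (-‿+-comm _ _) ⟩
    - fromℕ (suc m) + - fromℕ (suc n)   ∎
    where import Data.Nat.Properties as ℕ

  signValue : Sign → Carrier
  signValue Sign.+ = 1#
  signValue Sign.- = - 1#

  signValue-* : ∀ s t → signValue (s Sign.* t) ≈ signValue s * signValue t
  signValue-* Sign.+ t        = sym (*-identityˡ _)
  signValue-* Sign.- Sign.+   = sym (*-identityʳ _)
  signValue-* Sign.- Sign.-   = begin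
    1#              ≈⟨ sym (-‿involutive 1#) ⟩
    - (- 1#)        ≈⟨ -‿cong (sym (-1*x≈-x 1#)) ⟩
    - (- 1# * 1#)   ≈⟨ -‿distribʳ-* _ _ ⟩
    - 1# * - 1#     ∎

  fromℤ-◃ : ∀ s n → fromℤ (s ℤ.◃ n) ≈ signValue s * fromℕ n
  fromℤ-◃ s      zero    = sym (zeroʳ _)
  fromℤ-◃ Sign.+ (suc n) = sym (*-identityˡ _)
  fromℤ-◃ Sign.- (suc n) = sym (-1*x≈-x _)

  fromℤ-sign : ∀ i → fromℤ i ≈ signValue (ℤ.sign i) * fromℕ ℤ.∣ i ∣
  fromℤ-sign (+ n)    = sym (*-identityˡ _)
  fromℤ-sign -[1+ n ] = sym (-1*x≈-x _)

  fromℤ-* : ∀ i j → fromℤ (i ℤ.* j) ≈ fromℤ i * fromℤ j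
  fromℤ-* i j = begin
    fromℤ (i ℤ.* j)
      ≈⟨ fromℤ-◃ (ℤ.sign i Sign.* ℤ.sign j) (ℤ.∣ i ∣ ℕ.* ℤ.∣ j ∣) ⟩
    signValue (ℤ.sign i Sign.* ℤ.sign j) * fromℕ (ℤ.∣ i ∣ ℕ.* ℤ.∣ j ∣)
      ≈⟨ *-cong (signValue-* (ℤ.sign i) (ℤ.sign j)) (fromℕ-* ℤ.∣ i ∣ ℤ.∣ j ∣) ⟩
    (signValue (ℤ.sign i) * signValue (ℤ.sign j)) * (fromℕ ℤ.∣ i ∣ * fromℕ ℤ.∣ j ∣)
      ≈⟨ interchange _ _ _ _ ⟩
    (signValue (ℤ.sign i) * fromℕ ℤ.∣ i ∣) * (signValue (ℤ.sign j) * fromℕ ℤ.∣ j ∣)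
      ≈⟨ sym (*-cong (fromℤ-sign i) (fromℤ-sign j)) ⟩
    fromℤ i * fromℤ j ∎
    where
    interchange : ∀ a b c d → (a * b) * (c * d) ≈ (a * c) * (b * d)
    interchange a b c d = begin
      (a * b) * (c * d)  ≈⟨ *-assoc _ _ _ ⟩
      a * (b * (c * d))  ≈⟨ *-congˡ (sym (*-assoc _ _ _)) ⟩
      a * ((b * c) * d)  ≈⟨ *-congˡ (*-congʳ (*-comm _ _)) ⟩
      a * ((c * b) * d)  ≈⟨ *-congˡ (*-assoc _ _ _) ⟩
      a * (c * (b * d))  ≈⟨ sym (*-assoc _ _ _) ⟩
      (a * c) * (b * d)  ∎

  fromℤ-neg : ∀ i → fromℤ (ℤ.- i) ≈ - fromℤ i
  fromℤ-neg (+ zero)  = sym -0#≈0#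
  fromℤ-neg (+ suc n) = refl
  fromℤ-neg -[1+ n ]  = sym (-‿involutive _)

  fromℤ-homomorphism : ℤ.+-*-rawRing -Raw-AlmostCommutative⟶ fromCommutativeRing R
  fromℤ-homomorphism = record
    { ⟦_⟧    = fromℤ
    ; +-homo = fromℤ-+
    ; *-homo = fromℤ-*
    ; -‿homo = fromℤ-neg
    ; 0-homo = refl
    ; 1-homo = +-identityʳ 1#
    }

  fromℤ-≟ : ∀ i j → Maybe (fromℤ i ≈ fromℤ j)
  fromℤ-≟ i j with i ℤ.≟ j
  ... | yes ≡.refl = just refl
  ... | no _       = nothing

  open import Algebra.Solver.Ring ℤ.+-*-rawRing (fromCommutativeRing R) fromℤ-homomorphism fromℤ-≟ public

module FieldProperties (K : Field) where

  open import Data.Nat using (zero; suc)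
  open import Data.Fin using (Fin; zero; suc)
  open import Data.List using (List; []; _∷_; filter; length)
  open import Data.List.Relation.Unary.All using (All; []; _∷_)
  open import Data.Sum using (_⊎_; inj₁; inj₂)
  open import Data.Empty using (⊥-elim)
  open import Relation.Nullary using (Dec; yes; no)
  open import Relation.Binary.PropositionalEquality
  import Data.Integer as ℤ

  open Field K public

  commutativeRing : CommutativeRing _ _
  commutativeRing = record { isCommutativeRing = isCommutativeRing }

  open CommutativeRing commutativeRing public
    using ( +-assoc; +-comm; +-identityˡ; +-identityʳ; -‿inverseʳ
          ; *-assoc; *-comm; *-identityˡ; *-identityʳ; distribˡ; distribʳ; zeroˡ; zeroʳ)
  open IntegerSolver commutativeRing public using (solve; _:=_; _:+_; _:*_; :-_; _:-_; con)
  open ≡-Reasoning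

  1≢0 : 1# ≢ 0#
  1≢0 1≡0 = 0≢1 (sym 1≡0)

  -0≡0 : - 0# ≡ 0#
  -0≡0 = solve 0 (:- con (ℤ.+ 0) := con (ℤ.+ 0)) refl

  -‿involutive : ∀ x → - - x ≡ x
  -‿involutive = solve 1 (λ x → :- :- x := x) refl

  x-y≡0⇒x≡y : ∀ {x y} → x - y ≡ 0# → x ≡ y
  x-y≡0⇒x≡y {x} {y} e = begin
    x            ≡⟨ solve 2 (λ x y → x := (x :- y) :+ y) refl x y ⟩
    (x - y) + y  ≡⟨ cong (_+ y) e ⟩
    0# + y       ≡⟨ +-identityˡ y ⟩
    y            ∎

  [x*x⁻¹]*y≡y : ∀ {x} y → x ≢ 0# → (x * x ⁻¹) * y ≡ y
  [x*x⁻¹]*y≡y {x} y x≢0 = trans (cong (_* y) (⁻¹-inverse x x≢0)) (*-identityˡ y)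

  x⁻¹*[x*y]≡y : ∀ {x} y → x ≢ 0# → x ⁻¹ * (x * y) ≡ y
  x⁻¹*[x*y]≡y {x} y x≢0 = begin
    x ⁻¹ * (x * y)  ≡⟨ solve 3 (λ x a y → a :* (x :* y) := (x :* a) :* y) refl x (x ⁻¹) y ⟩
    (x * x ⁻¹) * y  ≡⟨ [x*x⁻¹]*y≡y y x≢0 ⟩
    y               ∎

  x*[x⁻¹*y]≡y : ∀ {x} y → x ≢ 0# → x * (x ⁻¹ * y) ≡ y
  x*[x⁻¹*y]≡y {x} y x≢0 = trans (solve 3 (λ x a y → x :* (a :* y) := a :* (x :* y)) refl x (x ⁻¹) y) (x⁻¹*[x*y]≡y y x≢0)

  x*y≡0⇒x≡0⊎y≡0 : ∀ x y → x * y ≡ 0# → x ≡ 0# ⊎ y ≡ 0#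
  x*y≡0⇒x≡0⊎y≡0 x y xy≡0 with x ≟ 0#
  ... | yes x≡0 = inj₁ x≡0
  ... | no  x≢0 = inj₂ (begin
    y               ≡⟨ sym (x⁻¹*[x*y]≡y y x≢0) ⟩
    x ⁻¹ * (x * y)  ≡⟨ cong (x ⁻¹ *_) xy≡0 ⟩
    x ⁻¹ * 0#       ≡⟨ zeroʳ _ ⟩
    0#              ∎)

  *-≢0 : ∀ {x y} → x ≢ 0# → y ≢ 0# → x * y ≢ 0#
  *-≢0 {x} {y} x≢0 y≢0 xy≡0 with x*y≡0⇒x≡0⊎y≡0 x y xy≡0
  ... | inj₁ x≡0 = x≢0 x≡0
  ... | inj₂ y≡0 = y≢0 y≡0

  ^-≢0 : ∀ {x} n → x ≢ 0# → x ^ n ≢ 0#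
  ^-≢0 zero    x≢0 = 1≢0
  ^-≢0 (suc n) x≢0 = *-≢0 x≢0 (^-≢0 n x≢0)

  ⁻¹-unique : ∀ x y → x * y ≡ 1# → y ≡ x ⁻¹
  ⁻¹-unique x y xy≡1 = begin
    y               ≡⟨ sym (x⁻¹*[x*y]≡y y x≢0) ⟩
    x ⁻¹ * (x * y)  ≡⟨ cong (x ⁻¹ *_) xy≡1 ⟩
    x ⁻¹ * 1#       ≡⟨ *-identityʳ _ ⟩
    x ⁻¹            ∎
    where
    x≢0 : x ≢ 0#
    x≢0 x≡0 = 0≢1 (trans (trans (sym (zeroˡ y)) (cong (_* y) (sym x≡0))) xy≡1)

  ⁻¹-≢0 : ∀ {x} → x ≢ 0# → x ⁻¹ ≢ 0#
  ⁻¹-≢0 {x} x≢0 x⁻¹≡0 = 1≢0 (trans (sym (⁻¹-inverse x x≢0)) (trans (cong (x *_) x⁻¹≡0) (zeroʳ x)))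

  ⁻¹-distrib-* : ∀ {x y} → x ≢ 0# → y ≢ 0# → (x * y) ⁻¹ ≡ x ⁻¹ * y ⁻¹
  ⁻¹-distrib-* {x} {y} x≢0 y≢0 = sym (⁻¹-unique (x * y) (x ⁻¹ * y ⁻¹) (begin
    x * y * (x ⁻¹ * y ⁻¹)      ≡⟨ solve 4 (λ x y a b → x :* y :* (a :* b) := (x :* a) :* (y :* b)) refl x y (x ⁻¹) (y ⁻¹) ⟩
    (x * x ⁻¹) * (y * y ⁻¹)    ≡⟨ cong₂ _*_ (⁻¹-inverse x x≢0) (⁻¹-inverse y y≢0) ⟩
    1# * 1#                    ≡⟨ *-identityˡ 1# ⟩
    1#                         ∎))

  ⁻¹-involutive : ∀ {x} → x ≢ 0# → x ⁻¹ ⁻¹ ≡ x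
  ⁻¹-involutive {x} x≢0 = sym (⁻¹-unique (x ⁻¹) x (trans (*-comm _ _) (⁻¹-inverse x x≢0)))

  1⁻¹≡1 : 1# ⁻¹ ≡ 1#
  1⁻¹≡1 = sym (⁻¹-unique 1# 1# (*-identityˡ 1#))

  ⁻¹-distrib-^ : ∀ {x} n → x ≢ 0# → (x ^ n) ⁻¹ ≡ (x ⁻¹) ^ n
  ⁻¹-distrib-^ zero    x≢0 = 1⁻¹≡1
  ⁻¹-distrib-^ (suc n) x≢0 = trans (⁻¹-distrib-* x≢0 (^-≢0 n x≢0)) (cong (_ *_) (⁻¹-distrib-^ n x≢0))

  *-cancelˡ : ∀ {c} x y → c ≢ 0# → c * x ≡ c * y → x ≡ y
  *-cancelˡ {c} x y c≢0 e = begin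
    x               ≡⟨ sym (x⁻¹*[x*y]≡y x c≢0) ⟩
    c ⁻¹ * (c * x)  ≡⟨ cong (c ⁻¹ *_) e ⟩
    c ⁻¹ * (c * y)  ≡⟨ x⁻¹*[x*y]≡y y c≢0 ⟩
    y               ∎

  c*x≡x⇒x≡0 : ∀ {c x} → c * x ≡ x → c ≢ 1# → x ≡ 0#
  c*x≡x⇒x≡0 {c} {x} cx≡x c≢1 with x*y≡0⇒x≡0⊎y≡0 (c - 1#) x (begin
      (c - 1#) * x         ≡⟨ solve 3 (λ c x o → (c :- o) :* x := c :* x :- o :* x) refl c x 1# ⟩
      (c * x) - (1# * x)   ≡⟨ cong₂ _-_ cx≡x (*-identityˡ x) ⟩
      x - x                ≡⟨ -‿inverseʳ x ⟩
      0#                   ∎)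
  ... | inj₁ c-1≡0 = ⊥-elim (c≢1 (x-y≡0⇒x≡y c-1≡0))
  ... | inj₂ x≡0   = x≡0

  x*x≡1⇒x≡1⊎x≡-1 : ∀ x → x * x ≡ 1# → x ≡ 1# ⊎ x ≡ - 1#
  x*x≡1⇒x≡1⊎x≡-1 x xx≡1 with x*y≡0⇒x≡0⊎y≡0 (x - 1#) (x + 1#) (begin
      (x - 1#) * (x + 1#)  ≡⟨ solve 2 (λ x o → (x :- o) :* (x :+ o) := x :* x :- o :* o) refl x 1# ⟩
      (x * x) - (1# * 1#)  ≡⟨ cong₂ _-_ xx≡1 (*-identityˡ 1#) ⟩
      1# - 1#              ≡⟨ -‿inverseʳ 1# ⟩
      0#                   ∎)
  ... | inj₁ x-1≡0 = inj₁ (x-y≡0⇒x≡y x-1≡0)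
  ... | inj₂ x+1≡0 = inj₂ (x-y≡0⇒x≡y (trans (cong (x +_) (-‿involutive 1#)) x+1≡0))

  sumL-cong : ∀ {A : Set} (xs : List A) {f h : A → Carrier} → (∀ x → f x ≡ h x) → sumL xs f ≡ sumL xs h
  sumL-cong []       f≗h = refl
  sumL-cong (x ∷ xs) f≗h = cong₂ _+_ (f≗h x) (sumL-cong xs f≗h)

  sumL-congᴬ : ∀ {A : Set} {P : A → Set} {xs : List A} {f h : A → Carrier} →
               All P xs → (∀ x → P x → f x ≡ h x) → sumL xs f ≡ sumL xs h
  sumL-congᴬ []         f≗h = refl
  sumL-congᴬ (px ∷ pxs) f≗h = cong₂ _+_ (f≗h _ px) (sumL-congᴬ pxs f≗h)

  sumL-zero : ∀ {A : Set} (xs : List A) → sumL xs (λ _ → 0#) ≡ 0#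
  sumL-zero []       = refl
  sumL-zero (x ∷ xs) = trans (cong (0# +_) (sumL-zero xs)) (+-identityˡ 0#)

  sumL-+ : ∀ {A : Set} (xs : List A) (f h : A → Carrier) → sumL xs (λ x → f x + h x) ≡ sumL xs f + sumL xs h
  sumL-+ []       f h = sym (+-identityˡ 0#)
  sumL-+ (x ∷ xs) f h = trans (cong (f x + h x +_) (sumL-+ xs f h))
    (solve 4 (λ a b c d → (a :+ b) :+ (c :+ d) := (a :+ c) :+ (b :+ d)) refl (f x) (h x) (sumL xs f) (sumL xs h))

  *-distribˡ-sumL : ∀ {A : Set} (xs : List A) c (f : A → Carrier) → c * sumL xs f ≡ sumL xs (λ x → c * f x)
  *-distribˡ-sumL []       c f = zeroʳ c
  *-distribˡ-sumL (x ∷ xs) c f = trans (distribˡ c (f x) _) (cong (c * f x +_) (*-distribˡ-sumL xs c f))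

  *-distribʳ-sumL : ∀ {A : Set} (xs : List A) c (f : A → Carrier) → sumL xs f * c ≡ sumL xs (λ x → f x * c)
  *-distribʳ-sumL xs c f = trans (*-comm _ c) (trans (*-distribˡ-sumL xs c f) (sumL-cong xs (λ x → *-comm c (f x))))

  -‿distrib-sumL : ∀ {A : Set} (xs : List A) (f : A → Carrier) → - sumL xs f ≡ sumL xs (λ x → - f x)
  -‿distrib-sumL []       f = -0≡0
  -‿distrib-sumL (x ∷ xs) f = trans (solve 2 (λ a b → :- (a :+ b) := :- a :+ :- b) refl (f x) (sumL xs f))
                                    (cong (- f x +_) (-‿distrib-sumL xs f))

  sumL-swap : ∀ {A B : Set} (xs : List A) (ys : List B) (f : A → B → Carrier) →
              sumL xs (λ a → sumL ys (f a)) ≡ sumL ys (λ b → sumL xs (λ a → f a b))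
  sumL-swap []       ys f = sym (sumL-zero ys)
  sumL-swap (x ∷ xs) ys f = trans (cong (sumL ys (f x) +_) (sumL-swap xs ys f))
                                  (sym (sumL-+ ys (f x) (λ b → sumL xs (λ a → f a b))))

  sumL-const : ∀ {A : Set} (xs : List A) c → sumL xs (λ _ → c) ≡ fromℕ (length xs) * c
  sumL-const []       c = sym (zeroˡ c)
  sumL-const (x ∷ xs) c = trans (cong (c +_) (sumL-const xs c))
    (trans (cong (_+ fromℕ (length xs) * c) (sym (*-identityˡ c))) (sym (distribʳ c 1# _)))

  indicator : ∀ {P : Set} → Dec P → Carrier → Carrier
  indicator (yes _) c = c
  indicator (no _)  c = 0#

  indicator-⇔ : ∀ {P Q : Set} (p : Dec P) (q : Dec Q) c → (P → Q) → (Q → P) → indicator p c ≡ indicator q c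
  indicator-⇔ (yes _) (yes _) c _   _   = refl
  indicator-⇔ (yes p) (no ¬q) c p⇒q _   = ⊥-elim (¬q (p⇒q p))
  indicator-⇔ (no ¬p) (yes q) c _   q⇒p = ⊥-elim (¬p (q⇒p q))
  indicator-⇔ (no _)  (no _)  c _   _   = refl

  sumL-filter : ∀ {A : Set} {P : A → Set} (P? : ∀ x → Dec (P x)) (xs : List A) (f : A → Carrier) →
                sumL (filter P? xs) f ≡ sumL xs (λ x → indicator (P? x) (f x))
  sumL-filter P? []       f = refl
  sumL-filter P? (x ∷ xs) f with P? x
  ... | yes _ = cong (f x +_) (sumL-filter P? xs f)
  ... | no  _ = trans (sumL-filter P? xs f) (sym (+-identityˡ _))

  prodFin-cong : ∀ n {f h : Fin n → Carrier} → (∀ i → f i ≡ h i) → prodFin n f ≡ prodFin n h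
  prodFin-cong zero    f≗h = refl
  prodFin-cong (suc n) f≗h = cong₂ _*_ (f≗h zero) (prodFin-cong n (λ i → f≗h (suc i)))

  prodFin-* : ∀ n (f h : Fin n → Carrier) → prodFin n (λ i → f i * h i) ≡ prodFin n f * prodFin n h
  prodFin-* zero    f h = sym (*-identityˡ 1#)
  prodFin-* (suc n) f h = trans (cong (f zero * h zero *_) (prodFin-* n (λ i → f (suc i)) (λ i → h (suc i))))
    (solve 4 (λ a b c d → (a :* b) :* (c :* d) := (a :* c) :* (b :* d)) refl (f zero) (h zero) _ _)

  prodFin-const : ∀ n c → prodFin n (λ _ → c) ≡ c ^ n
  prodFin-const zero    c = refl
  prodFin-const (suc n) c = cong (c *_) (prodFin-const n c)

  prodFin-≢0 : ∀ n {f : Fin n → Carrier} → (∀ i → f i ≢ 0#) → prodFin n f ≢ 0#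
  prodFin-≢0 zero    f≢0 = 1≢0
  prodFin-≢0 (suc n) f≢0 = *-≢0 (f≢0 zero) (prodFin-≢0 n (λ i → f≢0 (suc i)))

  prodFin-⁻¹ : ∀ n {f : Fin n → Carrier} → (∀ i → f i ≢ 0#) → prodFin n (λ i → f i ⁻¹) ≡ prodFin n f ⁻¹
  prodFin-⁻¹ zero    f≢0 = sym 1⁻¹≡1
  prodFin-⁻¹ (suc n) {f} f≢0 = trans (cong (f zero ⁻¹ *_) (prodFin-⁻¹ n (λ i → f≢0 (suc i))))
    (sym (⁻¹-distrib-* (f≢0 zero) (prodFin-≢0 n (λ i → f≢0 (suc i)))))

module FiniteFieldSums (F : FiniteField) (K : Field) (charZero : CharZero K) where

  open import Data.Nat using (suc)
  open import Data.Product using (∃; _,_)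
  open import Data.Empty using (⊥-elim)
  open import Data.List using (List; []; _∷_; length)
  open import Data.List.Relation.Unary.All using (All; []; _∷_)
  open import Data.List.Relation.Unary.All.Properties using (All¬⇒¬Any)
  open import Data.List.Relation.Unary.AllPairs using (AllPairs; _∷_)
  open import Data.List.Relation.Unary.Any using (here; there)
  open import Data.List.Membership.Propositional using (_∈_)
  open import Data.List.Membership.Propositional.Properties using (∈-filter⁺)
  open import Relation.Nullary using (yes; no; ¬?)
  open import Relation.Binary.PropositionalEquality

  open FieldProperties K
  module F = FiniteField F
  module 𝔽 = FieldProperties F.field'
  open ≡-Reasoning

  sumAll : (F.Carrier → Carrier) → Carrier
  sumAll f = sumL F.elements f

  sumUnits : (F.Carrier → Carrier) → Carrier
  sumUnits f = sumL F.units f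

  private
    sumL-indicator-∉ : ∀ (xs : List F.Carrier) a (f : F.Carrier → Carrier) → All (a ≢_) xs →
                       sumL xs (λ x → indicator (x F.≟ a) (f x)) ≡ 0#
    sumL-indicator-∉ []       a f []           = refl
    sumL-indicator-∉ (x ∷ xs) a f (a≢x ∷ a∉xs) with x F.≟ a
    ... | yes x≡a = ⊥-elim (a≢x (sym x≡a))
    ... | no  _   = trans (+-identityˡ _) (sumL-indicator-∉ xs a f a∉xs)

    sumL-indicator-∈ : ∀ (xs : List F.Carrier) a (f : F.Carrier → Carrier) → AllPairs _≢_ xs → a ∈ xs →
                       sumL xs (λ x → indicator (x F.≟ a) (f x)) ≡ f a
    sumL-indicator-∈ (x ∷ xs) a f (x∉xs ∷ _) (here refl) with x F.≟ x
    ... | yes _   = trans (cong (f x +_) (sumL-indicator-∉ xs x f x∉xs)) (+-identityʳ _)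
    ... | no  x≢x = ⊥-elim (x≢x refl)
    sumL-indicator-∈ (x ∷ xs) a f (x∉xs ∷ u) (there a∈xs) with x F.≟ a
    ... | yes refl = ⊥-elim (All¬⇒¬Any x∉xs a∈xs)
    ... | no  _    = trans (+-identityˡ _) (sumL-indicator-∈ xs a f u a∈xs)

  sumAll-indicator : ∀ a (f : F.Carrier → Carrier) → sumAll (λ x → indicator (x F.≟ a) (f x)) ≡ f a
  sumAll-indicator a f = sumL-indicator-∈ F.elements a f F.unique (F.complete a)

  sumAll-indicator′ : ∀ a (f : F.Carrier → Carrier) → sumAll (λ x → indicator (a F.≟ x) (f x)) ≡ f a
  sumAll-indicator′ a f =
    trans (sumL-cong F.elements (λ x → indicator-⇔ (a F.≟ x) (x F.≟ a) (f x) sym sym)) (sumAll-indicator a f)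

  -- Exchanging f (h x) for a sum of f y over the y with h x ≡ y turns reindexing into a swap of sums.
  sumAll-reindex : ∀ (h h′ : F.Carrier → F.Carrier) → (∀ y → h (h′ y) ≡ y) → (∀ x → h′ (h x) ≡ x) →
                   ∀ f → sumAll (λ x → f (h x)) ≡ sumAll f
  sumAll-reindex h h′ hh′ h′h f = begin
    sumAll (λ x → f (h x))
      ≡⟨ sumL-cong F.elements (λ x → sym (sumAll-indicator′ (h x) f)) ⟩
    sumAll (λ x → sumAll (λ y → indicator (h x F.≟ y) (f y)))
      ≡⟨ sumL-swap F.elements F.elements _ ⟩
    sumAll (λ y → sumAll (λ x → indicator (h x F.≟ y) (f y)))
      ≡⟨ sumL-cong F.elements (λ y → sumL-cong F.elements (λ x →
           indicator-⇔ (h x F.≟ y) (x F.≟ h′ y) (f y) (λ e → trans (sym (h′h x)) (cong h′ e)) (λ e → trans (cong h e) (hh′ y)))) ⟩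
    sumAll (λ y → sumAll (λ x → indicator (x F.≟ h′ y) (f y)))
      ≡⟨ sumL-cong F.elements (λ y → sumAll-indicator (h′ y) (λ _ → f y)) ⟩
    sumAll f ∎

  sumAll-translate : ∀ a f → sumAll (λ x → f (a F.+ x)) ≡ sumAll f
  sumAll-translate a = sumAll-reindex (a F.+_) (F.- a F.+_)
    (𝔽.solve 2 (λ a y → a 𝔽.:+ (𝔽.:- a 𝔽.:+ y) 𝔽.:= y) refl a)
    (𝔽.solve 2 (λ a y → 𝔽.:- a 𝔽.:+ (a 𝔽.:+ y) 𝔽.:= y) refl a)

  sumAll-dilate : ∀ {c} → c ≢ F.0# → ∀ f → sumAll (λ x → f (c F.* x)) ≡ sumAll f
  sumAll-dilate {c} c≢0 = sumAll-reindex (c F.*_) (c F.⁻¹ F.*_) (λ y → 𝔽.x*[x⁻¹*y]≡y y c≢0) (λ y → 𝔽.x⁻¹*[x*y]≡y y c≢0)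

  sumAll-negate : ∀ f → sumAll (λ x → f (F.- x)) ≡ sumAll f
  sumAll-negate = sumAll-reindex F.-_ F.-_ 𝔽.-‿involutive 𝔽.-‿involutive

  sumAll-reflect : ∀ f → sumAll (λ x → f (F.1# F.- x)) ≡ sumAll f
  sumAll-reflect = sumAll-reindex (λ x → F.1# F.- x) (λ x → F.1# F.- x) 1-[1-x]≡x 1-[1-x]≡x
    where
    1-[1-x]≡x : ∀ x → F.1# F.- (F.1# F.- x) ≡ x
    1-[1-x]≡x = 𝔽.solve 2 (λ o x → o 𝔽.:- (o 𝔽.:- x) 𝔽.:= x) refl F.1#

  sumAll≡f0+sumUnits : ∀ f → sumAll f ≡ f F.0# + sumUnits f
  sumAll≡f0+sumUnits f = begin
    sumAll f
      ≡⟨ sumL-cong F.elements split ⟩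
    sumAll (λ x → indicator (x F.≟ F.0#) (f x) + indicator (¬? (x F.≟ F.0#)) (f x))
      ≡⟨ sumL-+ F.elements _ _ ⟩
    sumAll (λ x → indicator (x F.≟ F.0#) (f x)) + sumAll (λ x → indicator (¬? (x F.≟ F.0#)) (f x))
      ≡⟨ cong₂ _+_ (sumAll-indicator F.0# f) (sym (sumL-filter (λ x → ¬? (x F.≟ F.0#)) F.elements f)) ⟩
    f F.0# + sumUnits f ∎
    where
    split : ∀ x → f x ≡ indicator (x F.≟ F.0#) (f x) + indicator (¬? (x F.≟ F.0#)) (f x)
    split x with x F.≟ F.0#
    ... | yes _ = sym (+-identityʳ _)
    ... | no  _ = sym (+-identityˡ _)

  sumUnits≡sumAll-f0 : ∀ f → sumUnits f ≡ sumAll f - f F.0#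
  sumUnits≡sumAll-f0 f = begin
    sumUnits f                   ≡⟨ solve 2 (λ u a → u := (a :+ u) :- a) refl (sumUnits f) (f F.0#) ⟩
    (f F.0# + sumUnits f) - f F.0#  ≡⟨ cong (_- f F.0#) (sym (sumAll≡f0+sumUnits f)) ⟩
    sumAll f - f F.0#            ∎

  sumUnits≡sumAll : ∀ f → f F.0# ≡ 0# → sumUnits f ≡ sumAll f
  sumUnits≡sumAll f f0≡0 = sym (trans (sumAll≡f0+sumUnits f) (trans (cong (_+ sumUnits f) f0≡0) (+-identityˡ _)))

  sumUnits-cong : ∀ {f h : F.Carrier → Carrier} → (∀ x → x ≢ F.0# → f x ≡ h x) → sumUnits f ≡ sumUnits h
  sumUnits-cong {f} {h} f≗h = begin
    sumUnits f                                              ≡⟨ sumL-filter (λ x → ¬? (x F.≟ F.0#)) F.elements f ⟩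
    sumAll (λ x → indicator (¬? (x F.≟ F.0#)) (f x))  ≡⟨ sumL-cong F.elements pointwise ⟩
    sumAll (λ x → indicator (¬? (x F.≟ F.0#)) (h x))  ≡⟨ sym (sumL-filter (λ x → ¬? (x F.≟ F.0#)) F.elements h) ⟩
    sumUnits h                                              ∎
    where
    pointwise : ∀ x → indicator (¬? (x F.≟ F.0#)) (f x) ≡ indicator (¬? (x F.≟ F.0#)) (h x)
    pointwise x with x F.≟ F.0#
    ... | yes _   = refl
    ... | no  x≢0 = f≗h x x≢0

  qK : Carrier
  qK = fromℕ F.q

  qK≡sumAll1 : qK ≡ sumAll (λ _ → 1#)
  qK≡sumAll1 = sym (trans (sumL-const F.elements 1#) (*-identityʳ _))

  private
    length-∈ : ∀ {a} (xs : List F.Carrier) → a ∈ xs → ∃ λ k → length xs ≡ suc k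
    length-∈ (x ∷ xs) _ = length xs , refl

  qK≢0 : qK ≢ 0#
  qK≢0 with length-∈ F.elements (F.complete F.0#)
  ... | k , q≡1+k = subst (λ m → fromℕ m ≢ 0#) (sym q≡1+k) (charZero k)

  1-qK≢0 : 1# - qK ≢ 0#
  1-qK≢0 1-q≡0 with length-∈ F.units (∈-filter⁺ (λ x → ¬? (x F.≟ F.0#)) (F.complete F.1#) 𝔽.1≢0)
  ... | k , ∣units∣≡1+k = charZero k (begin
    fromℕ (suc k)                         ≡⟨ cong fromℕ (sym ∣units∣≡1+k) ⟩
    fromℕ (length F.units)                ≡⟨ sym (*-identityʳ _) ⟩
    fromℕ (length F.units) * 1#           ≡⟨ sym (sumL-const F.units 1#) ⟩
    sumUnits (λ _ → 1#)                   ≡⟨ solve 2 (λ o u → u := :- (o :- (o :+ u))) refl 1# (sumUnits (λ _ → 1#)) ⟩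
    - (1# - (1# + sumUnits (λ _ → 1#)))   ≡⟨ cong (λ z → - (1# - z)) (sym (trans qK≡sumAll1 (sumAll≡f0+sumUnits _))) ⟩
    - (1# - qK)                           ≡⟨ cong -_ 1-q≡0 ⟩
    - 0#                                  ≡⟨ -0≡0 ⟩
    0#                                    ∎)

module GaussSums (F : FiniteField) (K : Field) (charZero : CharZero K)
                 (ψ : FiniteField.Carrier F → Field.Carrier K)
                 (ψ-isAddChar : Characters.IsNontrivAddChar F K ψ)
                 (chars : List (FiniteField.Carrier F → Field.Carrier K)) where

  open import Data.Nat using (ℕ; zero; suc)
  open import Data.Fin using (Fin; zero; suc)
  open import Data.Product using (∃; _×_; _,_)
  open import Data.Sum using (_⊎_; inj₁; inj₂)
  open import Data.Empty using (⊥-elim)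
  open import Data.List.Relation.Unary.All using (all?)
  import Data.List.Relation.Unary.All as All
  open import Data.List.Relation.Unary.All.Properties using (¬All⇒Any¬)
  open import Data.List.Relation.Unary.Any using (satisfied)
  open import Relation.Nullary using (yes; no)
  open import Relation.Binary.PropositionalEquality
  import Data.Integer as ℤ

  open FieldProperties K
  open FiniteFieldSums F K charZero public
  open Hyper F K ψ chars public hiding (qK; sumUnits)
  open Characters F K using (IsMultChar; module IsMultChar; module IsNontrivAddChar)
  open IsNontrivAddChar ψ-isAddChar public renaming (hom to ψ-hom; nontrivial to ψ-nontrivial)
  open ≡-Reasoning

  ε-0 : ε F.0# ≡ 0#
  ε-0 with F.0# F.≟ F.0#
  ... | yes _   = refl
  ... | no  0≢0 = ⊥-elim (0≢0 refl)

  ε-unit : ∀ {x} → x ≢ F.0# → ε x ≡ 1#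
  ε-unit {x} x≢0 with x F.≟ F.0#
  ... | yes x≡0 = ⊥-elim (x≢0 x≡0)
  ... | no  _   = refl

  conj-unit : ∀ η {x} → x ≢ F.0# → conj η x ≡ η x ⁻¹
  conj-unit η {x} x≢0 with x F.≟ F.0#
  ... | yes x≡0 = ⊥-elim (x≢0 x≡0)
  ... | no  _   = refl

  ε-isMultChar : IsMultChar ε
  ε-isMultChar = record { at-0 = ε-0 ; at-1 = ε-unit 𝔽.1≢0 ; hom = hom }
    where
    hom : ∀ x y → ε (x F.* y) ≡ ε x * ε y
    hom x y with x F.≟ F.0# | y F.≟ F.0#
    ... | yes refl | _        = trans (cong ε (𝔽.zeroˡ y)) (trans ε-0 (sym (zeroˡ _)))
    ... | no  _    | yes refl = trans (cong ε (𝔽.zeroʳ x)) (trans ε-0 (sym (zeroʳ _)))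
    ... | no  x≢0  | no  y≢0  = trans (ε-unit (𝔽.*-≢0 x≢0 y≢0)) (sym (*-identityˡ 1#))

  ·-isMultChar : ∀ {α β} → IsMultChar α → IsMultChar β → IsMultChar (α · β)
  ·-isMultChar {α} {β} α-mult β-mult = record
    { at-0 = trans (cong (_* β F.0#) (A.at-0)) (zeroˡ _)
    ; at-1 = trans (cong₂ _*_ A.at-1 B.at-1) (*-identityˡ 1#)
    ; hom  = λ x y → trans (cong₂ _*_ (A.hom x y) (B.hom x y))
               (solve 4 (λ a b c d → a :* b :* (c :* d) := a :* c :* (b :* d)) refl (α x) (α y) (β x) (β y))
    }
    where
    module A = IsMultChar α-mult
    module B = IsMultChar β-mult

  isMultChar-resp : ∀ {α β} → (∀ x → α x ≡ β x) → IsMultChar α → IsMultChar β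
  isMultChar-resp {α} {β} α≗β α-mult = record
    { at-0 = trans (sym (α≗β F.0#)) at-0
    ; at-1 = trans (sym (α≗β F.1#)) at-1
    ; hom  = λ x y → trans (sym (α≗β _)) (trans (hom x y) (cong₂ _*_ (α≗β x) (α≗β y)))
    }
    where open IsMultChar α-mult

  MultTuple : (n : ℕ) → (Fin n → Ch) → Set
  MultTuple n ν = ∀ i → IsMultChar (ν i)

  -- prodCh n ν is not itself a character when n = 0 (it is 1 at 0), so it is always paired with some α.
  ·-prodCh-isMultChar : ∀ n {α} (ν : Fin n → Ch) → IsMultChar α → MultTuple n ν →
                        IsMultChar (α · prodCh n ν)
  ·-prodCh-isMultChar zero    ν α-mult ν-mult = isMultChar-resp (λ x → sym (*-identityʳ _)) α-mult
  ·-prodCh-isMultChar (suc n) ν α-mult ν-mult = isMultChar-resp (λ x → *-assoc _ _ _)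
    (·-prodCh-isMultChar n (λ i → ν (suc i)) (·-isMultChar α-mult (ν-mult zero)) (λ i → ν-mult (suc i)))

  module MultChar {η : Ch} (η-mult : IsMultChar η) where
    open IsMultChar η-mult

    η[x]*η[x⁻¹]≡1 : ∀ {x} → x ≢ F.0# → η x * η (x F.⁻¹) ≡ 1#
    η[x]*η[x⁻¹]≡1 {x} x≢0 = trans (sym (hom x (x F.⁻¹))) (trans (cong η (F.⁻¹-inverse x x≢0)) at-1)

    unit-≢0 : ∀ {x} → x ≢ F.0# → η x ≢ 0#
    unit-≢0 {x} x≢0 ηx≡0 = 1≢0 (trans (sym (η[x]*η[x⁻¹]≡1 x≢0)) (trans (cong (_* η (x F.⁻¹)) ηx≡0) (zeroˡ _)))

    ⁻¹-homo : ∀ {x} → x ≢ F.0# → η (x F.⁻¹) ≡ η x ⁻¹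
    ⁻¹-homo x≢0 = ⁻¹-unique _ _ (η[x]*η[x⁻¹]≡1 x≢0)

    -- Dilating by a with η a ≢ 1 multiplies the sum by η a.
    orthogonality : ∀ {a} → a ≢ F.0# → η a ≢ 1# → sumAll η ≡ 0#
    orthogonality {a} a≢0 ηa≢1 = c*x≡x⇒x≡0
      (trans (*-distribˡ-sumL F.elements (η a) η) (trans (sumL-cong F.elements (λ x → sym (hom a x))) (sumAll-dilate a≢0 η)))
      ηa≢1

  Trivial : Ch → Set
  Trivial η = ∀ {x} → x ≢ F.0# → η x ≡ 1#

  NonTrivial : Ch → Set
  NonTrivial η = ∃ λ a → a ≢ F.0# × η a ≢ 1#

  trivial-or-nonTrivial : ∀ η → IsMultChar η → (δ η ≡ 1 × Trivial η) ⊎ (δ η ≡ 0 × NonTrivial η)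
  trivial-or-nonTrivial η η-mult with all? (λ x → η x ≟ ε x) F.elements
  ... | yes η≗ε = inj₁ (refl , λ {x} x≢0 → trans (All.lookup η≗ε (F.complete x)) (ε-unit x≢0))
  ... | no  η≉ε with satisfied (¬All⇒Any¬ (λ x → η x ≟ ε x) F.elements η≉ε)
  ...   | a , ηa≢εa = inj₂ (refl , a , a≢0 , λ ηa≡1 → ηa≢εa (trans ηa≡1 (sym (ε-unit a≢0))))
    where
    a≢0 : a ≢ F.0#
    a≢0 refl = ηa≢εa (trans (IsMultChar.at-0 η-mult) (sym ε-0))

  G : Ch → Carrier
  G η = sumUnits (λ x → ψ x * η x)

  Gbar : Ch → Carrier
  Gbar η = sumUnits (λ t → ψ (F.- t) * conj η t)

  G-cong : ∀ {η η′} → (∀ x → x ≢ F.0# → η x ≡ η′ x) → G η ≡ G η′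
  G-cong η≗η′ = sumUnits-cong (λ x x≢0 → cong (ψ x *_) (η≗η′ x x≢0))

  g-cong : ∀ {η η′} → (∀ x → x ≢ F.0# → η x ≡ η′ x) → g η ≡ g η′
  g-cong η≗η′ = cong -_ (G-cong η≗η′)

  ψ0≡0⊎ψ0≡1 : ψ F.0# ≡ 0# ⊎ ψ F.0# ≡ 1#
  ψ0≡0⊎ψ0≡1 with x*y≡0⇒x≡0⊎y≡0 (ψ F.0#) (ψ F.0# - 1#) (begin
      ψ F.0# * (ψ F.0# - 1#)           ≡⟨ solve 2 (λ a o → a :* (a :- o) := a :* a :- a :* o) refl (ψ F.0#) 1# ⟩
      (ψ F.0# * ψ F.0#) - (ψ F.0# * 1#)  ≡⟨ cong₂ _-_ (sym (trans (cong ψ (sym (𝔽.+-identityˡ F.0#))) (ψ-hom F.0# F.0#))) (*-identityʳ _) ⟩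
      ψ F.0# - ψ F.0#                  ≡⟨ -‿inverseʳ _ ⟩
      0#                               ∎)
  ... | inj₁ ψ0≡0   = inj₁ ψ0≡0
  ... | inj₂ ψ0-1≡0 = inj₂ (x-y≡0⇒x≡y ψ0-1≡0)

  module Nondegenerate (ψ0≡1 : ψ F.0# ≡ 1#) where

    sumAll-ψ : sumAll ψ ≡ 0#
    sumAll-ψ with ψ-nontrivial
    ... | a , ψa≢1 = c*x≡x⇒x≡0
      (trans (*-distribˡ-sumL F.elements (ψ a) ψ) (trans (sumL-cong F.elements (λ x → sym (ψ-hom a x))) (sumAll-translate a ψ)))
      ψa≢1

    sumAll-ψ-dilate : ∀ {c} → c ≢ F.0# → sumAll (λ x → ψ (x F.* c)) ≡ 0#
    sumAll-ψ-dilate c≢0 = trans (sumL-cong F.elements (λ x → cong ψ (𝔽.*-comm x _))) (trans (sumAll-dilate c≢0 ψ) sumAll-ψ)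

    sumUnits-ψ-dilate : ∀ x → sumUnits (λ t → ψ (t F.* (x F.- F.1#))) ≡ indicator (x F.≟ F.1#) qK - 1#
    sumUnits-ψ-dilate x with x F.≟ F.1#
    ... | yes refl = begin
      sumUnits (λ t → ψ (t F.* (F.1# F.- F.1#)))  ≡⟨ sumUnits-cong (λ t _ → trans (cong ψ (𝔽.solve 2 (λ t o → t 𝔽.:* (o 𝔽.:- o) 𝔽.:= 𝔽.con (ℤ.+ 0)) refl t F.1#)) ψ0≡1) ⟩
      sumUnits (λ _ → 1#)                         ≡⟨ sumUnits≡sumAll-f0 _ ⟩
      sumAll (λ _ → 1#) - 1#                      ≡⟨ cong (_- 1#) (sym qK≡sumAll1) ⟩
      qK - 1#                                     ∎
    ... | no x≢1 = begin
      sumUnits (λ t → ψ (t F.* (x F.- F.1#)))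
        ≡⟨ sumUnits≡sumAll-f0 _ ⟩
      sumAll (λ t → ψ (t F.* (x F.- F.1#))) - ψ (F.0# F.* (x F.- F.1#))
        ≡⟨ cong₂ _-_ (sumAll-ψ-dilate (λ x-1≡0 → x≢1 (𝔽.x-y≡0⇒x≡y x-1≡0))) (trans (cong ψ (𝔽.zeroˡ _)) ψ0≡1) ⟩
      0# - 1# ∎

    G≡sumAll : ∀ {η} → IsMultChar η → G η ≡ sumAll (λ x → ψ x * η x)
    G≡sumAll η-mult = sumUnits≡sumAll _ (trans (cong (ψ F.0# *_) (IsMultChar.at-0 η-mult)) (zeroʳ _))

    -- Dilating the Gauss sum by t turns each term of G η * Gbar η into a sum of η x ψ(t(x - 1)).
    G*Gbar-term : ∀ {η} → IsMultChar η → ∀ {t} → t ≢ F.0# →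
                  G η * (ψ (F.- t) * conj η t) ≡ sumAll (λ x → η x * ψ (t F.* (x F.- F.1#)))
    G*Gbar-term {η} η-mult {t} t≢0 = begin
      G η * (ψ (F.- t) * conj η t)
        ≡⟨ cong₂ _*_ (G≡sumAll η-mult) (cong (ψ (F.- t) *_) (conj-unit η t≢0)) ⟩
      sumAll (λ x → ψ x * η x) * (ψ (F.- t) * η t ⁻¹)
        ≡⟨ *-distribʳ-sumL F.elements _ _ ⟩
      sumAll (λ x → ψ x * η x * (ψ (F.- t) * η t ⁻¹))
        ≡⟨ sym (sumAll-dilate t≢0 _) ⟩
      sumAll (λ x → ψ (t F.* x) * η (t F.* x) * (ψ (F.- t) * η t ⁻¹))
        ≡⟨ sumL-cong F.elements pointwise ⟩
      sumAll (λ x → η x * ψ (t F.* (x F.- F.1#))) ∎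
      where
      tx-t≡t[x-1] : ∀ x → t F.* x F.+ F.- t ≡ t F.* (x F.- F.1#)
      tx-t≡t[x-1] x = trans (cong (λ w → t F.* x F.+ F.- w) (sym (𝔽.*-identityʳ t)))
                            (𝔽.solve 3 (λ t x o → t 𝔽.:* x 𝔽.:+ 𝔽.:- (t 𝔽.:* o) 𝔽.:= t 𝔽.:* (x 𝔽.:- o)) refl t x F.1#)
      pointwise : ∀ x → ψ (t F.* x) * η (t F.* x) * (ψ (F.- t) * η t ⁻¹) ≡ η x * ψ (t F.* (x F.- F.1#))
      pointwise x = begin
        ψ (t F.* x) * η (t F.* x) * (ψ (F.- t) * η t ⁻¹)
          ≡⟨ cong (λ z → ψ (t F.* x) * z * (ψ (F.- t) * η t ⁻¹)) (IsMultChar.hom η-mult t x) ⟩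
        ψ (t F.* x) * (η t * η x) * (ψ (F.- t) * η t ⁻¹)
          ≡⟨ solve 5 (λ a b c d e → a :* (b :* c) :* (d :* e) := c :* (a :* d) :* (b :* e)) refl (ψ (t F.* x)) (η t) (η x) (ψ (F.- t)) (η t ⁻¹) ⟩
        η x * (ψ (t F.* x) * ψ (F.- t)) * (η t * η t ⁻¹)
          ≡⟨ cong₂ (λ u v → η x * u * v) (sym (ψ-hom _ _)) (⁻¹-inverse _ (MultChar.unit-≢0 η-mult t≢0)) ⟩
        η x * ψ (t F.* x F.+ F.- t) * 1#
          ≡⟨ trans (*-identityʳ _) (cong (λ z → η x * ψ z) (tx-t≡t[x-1] x)) ⟩
        η x * ψ (t F.* (x F.- F.1#)) ∎

    G*Gbar≡q : ∀ {η} → IsMultChar η → NonTrivial η → G η * Gbar η ≡ qK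
    G*Gbar≡q {η} η-mult (a , a≢0 , ηa≢1) = begin
      G η * Gbar η
        ≡⟨ *-distribˡ-sumL F.units (G η) _ ⟩
      sumUnits (λ t → G η * (ψ (F.- t) * conj η t))
        ≡⟨ sumUnits-cong (λ t t≢0 → G*Gbar-term η-mult t≢0) ⟩
      sumUnits (λ t → sumAll (λ x → η x * ψ (t F.* (x F.- F.1#))))
        ≡⟨ sumL-swap F.units F.elements _ ⟩
      sumAll (λ x → sumUnits (λ t → η x * ψ (t F.* (x F.- F.1#))))
        ≡⟨ sumL-cong F.elements (λ x → trans (sym (*-distribˡ-sumL F.units (η x) _)) (cong (η x *_) (sumUnits-ψ-dilate x))) ⟩
      sumAll (λ x → η x * (indicator (x F.≟ F.1#) qK - 1#))
        ≡⟨ sumL-cong F.elements split ⟩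
      sumAll (λ x → indicator (x F.≟ F.1#) (η x * qK) + - η x)
        ≡⟨ trans (sumL-+ F.elements _ _) (cong (sumAll (λ x → indicator (x F.≟ F.1#) (η x * qK)) +_) (sym (-‿distrib-sumL F.elements η))) ⟩
      sumAll (λ x → indicator (x F.≟ F.1#) (η x * qK)) - sumAll η
        ≡⟨ cong₂ _-_ (sumAll-indicator F.1# (λ x → η x * qK)) (MultChar.orthogonality η-mult a≢0 ηa≢1) ⟩
      (η F.1# * qK) - 0#
        ≡⟨ cong (λ z → (z * qK) - 0#) (IsMultChar.at-1 η-mult) ⟩
      (1# * qK) - 0#
        ≡⟨ solve 2 (λ o q → o :* q :- con (ℤ.+ 0) := o :* q) refl 1# qK ⟩
      1# * qK
        ≡⟨ *-identityˡ qK ⟩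
      qK ∎
      where
      split : ∀ x → η x * (indicator (x F.≟ F.1#) qK - 1#) ≡ indicator (x F.≟ F.1#) (η x * qK) + - η x
      split x with x F.≟ F.1#
      ... | yes _ = trans (solve 3 (λ e q o → e :* (q :- o) := e :* q :+ :- (e :* o)) refl (η x) qK 1#)
                          (cong (λ z → η x * qK + - z) (*-identityʳ _))
      ... | no  _ = trans (solve 2 (λ e o → e :* (con (ℤ.+ 0) :- o) := con (ℤ.+ 0) :+ :- (e :* o)) refl (η x) 1#)
                          (cong (λ z → 0# + - z) (*-identityʳ _))

    G-trivial : ∀ {η} → Trivial η → G η ≡ - 1#
    G-trivial {η} η-triv = begin
      G η                  ≡⟨ sumUnits-cong (λ x x≢0 → trans (cong (ψ x *_) (η-triv x≢0)) (*-identityʳ _)) ⟩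
      sumUnits ψ           ≡⟨ sumUnits≡sumAll-f0 ψ ⟩
      sumAll ψ - ψ F.0#    ≡⟨ cong₂ _-_ sumAll-ψ ψ0≡1 ⟩
      0# - 1#              ≡⟨ +-identityˡ _ ⟩
      - 1#                 ∎

    g-trivial : ∀ {η} → Trivial η → g η ≡ 1#
    g-trivial η-triv = trans (cong -_ (G-trivial η-triv)) (-‿involutive 1#)

    Gbar-trivial : ∀ {η} → Trivial η → Gbar η ≡ - 1#
    Gbar-trivial {η} η-triv = begin
      Gbar η                          ≡⟨ sumUnits-cong (λ t t≢0 → trans (cong (ψ (F.- t) *_) (conj-trivial t≢0)) (*-identityʳ _)) ⟩
      sumUnits (λ t → ψ (F.- t))      ≡⟨ sumUnits≡sumAll-f0 _ ⟩
      sumAll (λ t → ψ (F.- t)) - ψ (F.- F.0#)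
        ≡⟨ cong₂ _-_ (trans (sumAll-negate ψ) sumAll-ψ) (trans (cong ψ 𝔽.-0≡0) ψ0≡1) ⟩
      0# - 1#                         ≡⟨ +-identityˡ _ ⟩
      - 1#                            ∎
      where
      conj-trivial : ∀ {t} → t ≢ F.0# → conj η t ≡ 1#
      conj-trivial t≢0 = trans (conj-unit η t≢0) (trans (cong _⁻¹ (η-triv t≢0)) 1⁻¹≡1)

    g≢0 : ∀ {η} → IsMultChar η → g η ≢ 0#
    g≢0 {η} η-mult with trivial-or-nonTrivial η η-mult
    ... | inj₁ (_ , η-triv)    = λ gη≡0 → 1≢0 (trans (sym (g-trivial η-triv)) gη≡0)
    ... | inj₂ (_ , η-nontriv) = λ gη≡0 → qK≢0 (begin
      qK                  ≡⟨ sym (G*Gbar≡q η-mult η-nontriv) ⟩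
      G η * Gbar η        ≡⟨ cong (_* Gbar η) (sym (-‿involutive (G η))) ⟩
      - g η * Gbar η      ≡⟨ cong (λ z → - z * Gbar η) gη≡0 ⟩
      - 0# * Gbar η       ≡⟨ solve 1 (λ x → :- con (ℤ.+ 0) :* x := con (ℤ.+ 0)) refl (Gbar η) ⟩
      0#                  ∎)

    g°≢0 : ∀ {η} → IsMultChar η → g° η ≢ 0#
    g°≢0 {η} η-mult = *-≢0 (^-≢0 (δ η) qK≢0) (g≢0 η-mult)

    poch°≢0 : ∀ {α ν} → IsMultChar α → IsMultChar (α · ν) → poch° α ν ≢ 0#
    poch°≢0 α-mult αν-mult = *-≢0 (g°≢0 αν-mult) (⁻¹-≢0 (g°≢0 α-mult))

    Gbar≡-q/g° : ∀ {η} → IsMultChar η → Gbar η ≡ - (qK * g° η ⁻¹)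
    Gbar≡-q/g° {η} η-mult with trivial-or-nonTrivial η η-mult
    ... | inj₁ (δη≡1 , η-triv) = begin
      Gbar η                ≡⟨ Gbar-trivial η-triv ⟩
      - 1#                  ≡⟨ cong -_ (sym (⁻¹-inverse qK qK≢0)) ⟩
      - (qK * qK ⁻¹)        ≡⟨ cong (λ w → - (qK * w ⁻¹)) (sym g°η≡q) ⟩
      - (qK * g° η ⁻¹)      ∎
      where
      g°η≡q : g° η ≡ qK
      g°η≡q = trans (cong₂ _*_ (cong (qK ^_) δη≡1) (g-trivial η-triv)) (trans (*-identityʳ _) (*-identityʳ _))
    ... | inj₂ (δη≡0 , η-nontriv) = begin
      Gbar η                       ≡⟨ sym (x⁻¹*[x*y]≡y (Gbar η) (g≢0 η-mult)) ⟩
      g η ⁻¹ * (g η * Gbar η)      ≡⟨ solve 3 (λ a b c → a :* ((:- b) :* c) := :- (a :* (b :* c))) refl (g η ⁻¹) (G η) (Gbar η) ⟩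
      - (g η ⁻¹ * (G η * Gbar η))  ≡⟨ cong (λ w → - (g η ⁻¹ * w)) (G*Gbar≡q η-mult η-nontriv) ⟩
      - (g η ⁻¹ * qK)              ≡⟨ cong -_ (*-comm _ _) ⟩
      - (qK * g η ⁻¹)              ≡⟨ cong (λ w → - (qK * w ⁻¹)) (sym g°η≡gη) ⟩
      - (qK * g° η ⁻¹)             ∎
      where
      g°η≡gη : g° η ≡ g η
      g°η≡gη = trans (cong (λ k → qK ^ k * g η) δη≡0) (*-identityˡ _)

module QuadraticCharacter (F : FiniteField) (K : Field) (charZero : CharZero K)
                          (ψ : FiniteField.Carrier F → Field.Carrier K)
                          (ψ-isAddChar : Characters.IsNontrivAddChar F K ψ)
                          (chars : List (FiniteField.Carrier F → Field.Carrier K))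
                          (p : ℕ) (char-p : HasCharacteristic F p) (p≢2 : p ≢ 2) where

  open import Data.Nat as ℕ using (zero; suc)
  import Data.Nat.Properties as ℕ
  open import Data.Nat.Divisibility using (divides)
  open import Data.Nat.Primality using (prime⇒irreducible)
  open import Data.Product using (∃; _×_; _,_; proj₁; proj₂)
  open import Data.Sum using (_⊎_; inj₁; inj₂)
  open import Data.Empty using (⊥; ⊥-elim)
  open import Data.List using ([]; _∷_; map)
  open import Data.Nat.ListAction using (sum)
  open import Data.List.Relation.Unary.All using (All; []; _∷_)
  import Data.List.Relation.Unary.All as All
  open import Data.List.Relation.Unary.Any using (Any; any?; satisfied)
  import Data.List.Relation.Unary.Any as Any
  open import Data.List.Membership.Propositional.Properties using (∈-filter⁺)
  open import Relation.Nullary using (¬_; Dec; yes; no; ¬?)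
  open import Relation.Binary.PropositionalEquality
  open import Function using (_∘_)
  import Data.Integer as ℤ

  open FieldProperties K
  open GaussSums F K charZero ψ ψ-isAddChar chars
  open Characters F K using (IsMultChar; module IsMultChar)
  open ≡-Reasoning

  private
    even-or-odd : F.fromℕ 2 ≡ F.0# → ∀ n → ∃ λ k → (n ≡ k ℕ.* 2 × F.fromℕ n ≡ F.0#) ⊎ (n ≡ suc (k ℕ.* 2) × F.fromℕ n ≡ F.1#)
    even-or-odd 2≡0 zero = 0 , inj₁ (refl , refl)
    even-or-odd 2≡0 (suc n) with even-or-odd 2≡0 n
    ... | k , inj₁ (refl , n≡0) = k , inj₂ (refl , trans (cong (F.1# F.+_) n≡0) (𝔽.+-identityʳ _))
    ... | k , inj₂ (refl , n≡1) = suc k , inj₁ (refl , trans (cong (F.1# F.+_) (trans n≡1 (sym (𝔽.+-identityʳ F.1#)))) 2≡0)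

  2≢0 : F.fromℕ 2 ≢ F.0#
  2≢0 2≡0 with even-or-odd 2≡0 p
  ... | k , inj₁ (p≡2k , _) with prime⇒irreducible (proj₁ char-p) (divides k p≡2k)
  ...   | inj₁ ()
  ...   | inj₂ 2≡p = p≢2 (sym 2≡p)
  2≢0 2≡0 | k , inj₂ (_ , p≡1) = F.0≢1 (trans (sym (proj₂ char-p)) p≡1)

  ½ : F.Carrier
  ½ = F.fromℕ 2 F.⁻¹

  ¼ : F.Carrier
  ¼ = F.fromℕ 4 F.⁻¹

  ¼≡½*½ : ¼ ≡ ½ F.* ½
  ¼≡½*½ = trans (cong F._⁻¹ 4≡2*2) (𝔽.⁻¹-distrib-* 2≢0 2≢0)
    where
    4≡2*2 : F.fromℕ 4 ≡ F.fromℕ 2 F.* F.fromℕ 2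
    4≡2*2 = 𝔽.solve 0 (𝔽.con (ℤ.+ 4) 𝔽.:= 𝔽.con (ℤ.+ 2) 𝔽.:* 𝔽.con (ℤ.+ 2)) refl

  ¼≢0 : ¼ ≢ F.0#
  ¼≢0 = subst (_≢ F.0#) (sym ¼≡½*½) (𝔽.*-≢0 (𝔽.⁻¹-≢0 2≢0) (𝔽.⁻¹-≢0 2≢0))

  -1≢1 : - 1# ≢ 1#
  -1≢1 -1≡1 = charZero 1 (begin
    1# + (1# + 0#)  ≡⟨ cong (1# +_) (+-identityʳ 1#) ⟩
    1# + 1#         ≡⟨ cong (1# +_) (sym -1≡1) ⟩
    1# + - 1#       ≡⟨ -‿inverseʳ 1# ⟩
    0#              ∎)

  IsSquare : F.Carrier → Set
  IsSquare x = Any (λ y → y F.* y ≡ x) F.elements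

  isSquare? : ∀ x → Dec (IsSquare x)
  isSquare? x = any? (λ y → (y F.* y) F.≟ x) F.elements

  isSquare : ∀ {x} y → y F.* y ≡ x → IsSquare x
  isSquare y y²≡x = Any.map (λ { refl → y²≡x }) (F.complete y)

  isSquare-* : ∀ {x y} → IsSquare x → IsSquare y → IsSquare (x F.* y)
  isSquare-* x□ y□ with satisfied x□ | satisfied y□
  ... | a , a²≡x | b , b²≡y = isSquare (a F.* b)
    (trans (𝔽.solve 2 (λ a b → (a 𝔽.:* b) 𝔽.:* (a 𝔽.:* b) 𝔽.:= (a 𝔽.:* a) 𝔽.:* (b 𝔽.:* b)) refl a b) (cong₂ F._*_ a²≡x b²≡y))

  isSquare-÷ : ∀ {x y} → x ≢ F.0# → IsSquare x → IsSquare (x F.* y) → IsSquare y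
  isSquare-÷ {x} {y} x≢0 x□ xy□ with satisfied x□ | satisfied xy□
  ... | a , a²≡x | c , c²≡xy = isSquare (c F.* a F.⁻¹) (begin
    (c F.* a F.⁻¹) F.* (c F.* a F.⁻¹)   ≡⟨ 𝔽.solve 2 (λ c b → (c 𝔽.:* b) 𝔽.:* (c 𝔽.:* b) 𝔽.:= (b 𝔽.:* b) 𝔽.:* (c 𝔽.:* c)) refl c (a F.⁻¹) ⟩
    a⁻¹² F.* (c F.* c)                  ≡⟨ cong (a⁻¹² F.*_) (trans c²≡xy (cong (F._* y) (sym a²≡x))) ⟩
    a⁻¹² F.* ((a F.* a) F.* y)          ≡⟨ cong (F._* ((a F.* a) F.* y)) (sym (𝔽.⁻¹-distrib-* a≢0 a≢0)) ⟩
    (a F.* a) F.⁻¹ F.* ((a F.* a) F.* y) ≡⟨ 𝔽.x⁻¹*[x*y]≡y y (𝔽.*-≢0 a≢0 a≢0) ⟩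
    y                                   ∎)
    where
    a⁻¹² = a F.⁻¹ F.* a F.⁻¹
    a≢0 : a ≢ F.0#
    a≢0 refl = x≢0 (trans (sym a²≡x) (𝔽.zeroˡ _))

  φ-0 : φ F.0# ≡ 0#
  φ-0 with F.0# F.≟ F.0#
  ... | yes _   = refl
  ... | no  0≢0 = ⊥-elim (0≢0 refl)

  φ-square : ∀ {x} → x ≢ F.0# → IsSquare x → φ x ≡ 1#
  φ-square {x} x≢0 x□ with x F.≟ F.0#
  ... | yes x≡0 = ⊥-elim (x≢0 x≡0)
  ... | no  _ with isSquare? x
  ...   | yes _  = refl
  ...   | no  x⊠ = ⊥-elim (x⊠ x□)

  φ-nonSquare : ∀ {x} → x ≢ F.0# → ¬ IsSquare x → φ x ≡ - 1#
  φ-nonSquare {x} x≢0 x⊠ with x F.≟ F.0#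
  ... | yes x≡0 = ⊥-elim (x≢0 x≡0)
  ... | no  _ with isSquare? x
  ...   | yes x□ = ⊥-elim (x⊠ x□)
  ...   | no  _  = refl

  -1*-1≡1 : - 1# * - 1# ≡ 1#
  -1*-1≡1 = trans (solve 1 (λ o → :- o :* :- o := o :* o) refl 1#) (*-identityˡ 1#)

  φ[x]*φ[x]≡1 : ∀ {x} → x ≢ F.0# → φ x * φ x ≡ 1#
  φ[x]*φ[x]≡1 {x} x≢0 = byCases (isSquare? x)
    where
    byCases : Dec (IsSquare x) → φ x * φ x ≡ 1#
    byCases (yes x□) = trans (cong₂ _*_ (φ-square x≢0 x□) (φ-square x≢0 x□)) (*-identityˡ 1#)
    byCases (no  x⊠) = trans (cong₂ _*_ (φ-nonSquare x≢0 x⊠) (φ-nonSquare x≢0 x⊠)) -1*-1≡1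

  y²≡a²⇒y≡±a : ∀ y a → y F.* y ≡ a F.* a → y ≡ a ⊎ y ≡ F.- a
  y²≡a²⇒y≡±a y a y²≡a² with 𝔽.x*y≡0⇒x≡0⊎y≡0 (y F.- a) (y F.+ a) (begin
      (y F.- a) F.* (y F.+ a)      ≡⟨ 𝔽.solve 2 (λ y a → (y 𝔽.:- a) 𝔽.:* (y 𝔽.:+ a) 𝔽.:= y 𝔽.:* y 𝔽.:- a 𝔽.:* a) refl y a ⟩
      (y F.* y) F.- (a F.* a)      ≡⟨ cong (F._- (a F.* a)) y²≡a² ⟩
      (a F.* a) F.- (a F.* a)      ≡⟨ 𝔽.-‿inverseʳ _ ⟩
      F.0#                         ∎)
  ... | inj₁ y-a≡0 = inj₁ (𝔽.x-y≡0⇒x≡y y-a≡0)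
  ... | inj₂ y+a≡0 = inj₂ (𝔽.x-y≡0⇒x≡y (trans (cong (y F.+_) (𝔽.-‿involutive a)) y+a≡0))

  a≢-a : ∀ {a} → a ≢ F.0# → a ≢ F.- a
  a≢-a {a} a≢0 a≡-a = 𝔽.*-≢0 2≢0 a≢0 (begin
    F.fromℕ 2 F.* a   ≡⟨ 𝔽.solve 1 (λ a → 𝔽.con (ℤ.+ 2) 𝔽.:* a 𝔽.:= a 𝔽.:+ a) refl a ⟩
    a F.+ a           ≡⟨ cong (a F.+_) a≡-a ⟩
    a F.+ F.- a       ≡⟨ 𝔽.-‿inverseʳ a ⟩
    F.0#              ∎)

  #sqrt : F.Carrier → Carrier
  #sqrt w = sumAll (λ y → indicator ((y F.* y) F.≟ w) 1#)

  #sqrt-0 : #sqrt F.0# ≡ 1#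
  #sqrt-0 = begin
    #sqrt F.0#                                ≡⟨ sumL-cong F.elements (λ y → indicator-⇔ ((y F.* y) F.≟ F.0#) (y F.≟ F.0#) 1# y²≡0⇒y≡0 y≡0⇒y²≡0) ⟩
    sumAll (λ y → indicator (y F.≟ F.0#) 1#)  ≡⟨ sumAll-indicator F.0# (λ _ → 1#) ⟩
    1#                                        ∎
    where
    y²≡0⇒y≡0 : ∀ {y} → y F.* y ≡ F.0# → y ≡ F.0#
    y²≡0⇒y≡0 {y} y²≡0 with 𝔽.x*y≡0⇒x≡0⊎y≡0 y y y²≡0
    ... | inj₁ y≡0 = y≡0
    ... | inj₂ y≡0 = y≡0
    y≡0⇒y²≡0 : ∀ {y} → y ≡ F.0# → y F.* y ≡ F.0#
    y≡0⇒y²≡0 refl = 𝔽.zeroˡ F.0#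

  #sqrt-square : ∀ {w} → w ≢ F.0# → IsSquare w → #sqrt w ≡ 1# + 1#
  #sqrt-square {w} w≢0 w□ with satisfied w□
  ... | a , a²≡w = begin
    #sqrt w
      ≡⟨ sumL-cong F.elements roots ⟩
    sumAll (λ y → indicator (y F.≟ a) 1# + indicator (y F.≟ (F.- a)) 1#)
      ≡⟨ sumL-+ F.elements _ _ ⟩
    sumAll (λ y → indicator (y F.≟ a) 1#) + sumAll (λ y → indicator (y F.≟ (F.- a)) 1#)
      ≡⟨ cong₂ _+_ (sumAll-indicator a (λ _ → 1#)) (sumAll-indicator (F.- a) (λ _ → 1#)) ⟩
    1# + 1# ∎
    where
    a≢0 : a ≢ F.0#
    a≢0 refl = w≢0 (trans (sym a²≡w) (𝔽.zeroˡ _))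
    roots : ∀ y → indicator ((y F.* y) F.≟ w) 1# ≡ indicator (y F.≟ a) 1# + indicator (y F.≟ (F.- a)) 1#
    roots y with (y F.* y) F.≟ w | y F.≟ a | y F.≟ (F.- a)
    ... | _        | yes refl | yes y≡-y = ⊥-elim (a≢-a a≢0 y≡-y)
    ... | yes _    | yes _    | no  _    = sym (+-identityʳ 1#)
    ... | yes _    | no  _    | yes _    = sym (+-identityˡ 1#)
    ... | yes y²≡w | no  y≢a  | no  y≢-a with y²≡a²⇒y≡±a y a (trans y²≡w (sym a²≡w))
    ...   | inj₁ y≡a  = ⊥-elim (y≢a y≡a)
    ...   | inj₂ y≡-a = ⊥-elim (y≢-a y≡-a)
    roots y | no y²≢w | yes refl | _        = ⊥-elim (y²≢w a²≡w)
    roots y | no y²≢w | no _     | yes refl = ⊥-elim (y²≢w (trans (𝔽.solve 1 (λ a → 𝔽.:- a 𝔽.:* 𝔽.:- a 𝔽.:= a 𝔽.:* a) refl a) a²≡w))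
    roots y | no _    | no _     | no _     = sym (+-identityʳ 0#)

  #sqrt-nonSquare : ∀ {w} → ¬ IsSquare w → #sqrt w ≡ 0#
  #sqrt-nonSquare {w} w⊠ = trans (sumL-cong F.elements noRoot) (sumL-zero F.elements)
    where
    noRoot : ∀ y → indicator ((y F.* y) F.≟ w) 1# ≡ 0#
    noRoot y with (y F.* y) F.≟ w
    ... | yes y²≡w = ⊥-elim (w⊠ (isSquare y y²≡w))
    ... | no  _    = refl

  #sqrt≡1+φ : ∀ w → #sqrt w ≡ 1# + φ w
  #sqrt≡1+φ w = byCases w (w F.≟ F.0#) (isSquare? w)
    where
    byCases : ∀ w → Dec (w ≡ F.0#) → Dec (IsSquare w) → #sqrt w ≡ 1# + φ w
    byCases _ (yes refl) _        = trans #sqrt-0 (sym (trans (cong (1# +_) φ-0) (+-identityʳ 1#)))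
    byCases w (no w≢0)   (yes w□) = trans (#sqrt-square w≢0 w□) (cong (1# +_) (sym (φ-square w≢0 w□)))
    byCases w (no w≢0)   (no w⊠)  = begin
      #sqrt w      ≡⟨ #sqrt-nonSquare w⊠ ⟩
      0#           ≡⟨ sym (-‿inverseʳ 1#) ⟩
      1# + - 1#    ≡⟨ cong (1# +_) (sym (φ-nonSquare w≢0 w⊠)) ⟩
      1# + φ w     ∎

  sumAll-square : ∀ f → sumAll (λ y → f (y F.* y)) ≡ sumAll (λ w → f w * (1# + φ w))
  sumAll-square f = begin
    sumAll (λ y → f (y F.* y))
      ≡⟨ sumL-cong F.elements (λ y → sym (sumAll-indicator′ (y F.* y) f)) ⟩
    sumAll (λ y → sumAll (λ w → indicator ((y F.* y) F.≟ w) (f w)))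
      ≡⟨ sumL-swap F.elements F.elements _ ⟩
    sumAll (λ w → sumAll (λ y → indicator ((y F.* y) F.≟ w) (f w)))
      ≡⟨ sumL-cong F.elements (λ w → trans (sumL-cong F.elements (λ y → scale y w)) (sym (*-distribˡ-sumL F.elements (f w) _))) ⟩
    sumAll (λ w → f w * #sqrt w)
      ≡⟨ sumL-cong F.elements (λ w → cong (f w *_) (#sqrt≡1+φ w)) ⟩
    sumAll (λ w → f w * (1# + φ w)) ∎
    where
    scale : ∀ y w → indicator ((y F.* y) F.≟ w) (f w) ≡ f w * indicator ((y F.* y) F.≟ w) 1#
    scale y w with (y F.* y) F.≟ w
    ... | yes _ = sym (*-identityʳ _)
    ... | no  _ = sym (zeroʳ _)

  sumAll-square′ : ∀ f → sumAll (λ y → f (y F.* y)) ≡ sumAll f + sumAll (λ w → f w * φ w)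
  sumAll-square′ f = trans (sumAll-square f) (trans
    (sumL-cong F.elements (λ w → trans (distribˡ (f w) 1# (φ w)) (cong (_+ f w * φ w) (*-identityʳ _))))
    (sumL-+ F.elements _ _))

  sumAll-φ : sumAll φ ≡ 0#
  sumAll-φ = begin
    sumAll φ                                          ≡⟨ solve 2 (λ a b → b := (a :+ b) :- a) refl (sumAll (λ _ → 1#)) (sumAll φ) ⟩
    (sumAll (λ _ → 1#) + sumAll φ) - sumAll (λ _ → 1#)  ≡⟨ cong (_- sumAll (λ _ → 1#)) (sym sum1≡sum1+sumφ) ⟩
    sumAll (λ _ → 1#) - sumAll (λ _ → 1#)             ≡⟨ -‿inverseʳ _ ⟩
    0#                                                ∎
    where
    sum1≡sum1+sumφ : sumAll (λ _ → 1#) ≡ sumAll (λ _ → 1#) + sumAll φ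
    sum1≡sum1+sumφ = trans (sumAll-square′ (λ _ → 1#)) (cong (sumAll (λ _ → 1#) +_) (sumL-cong F.elements (λ w → *-identityˡ (φ w))))

  sumL-fromℕ≡0 : ∀ {A : Set} (xs : List A) (k : A → ℕ) → sumL xs (λ x → fromℕ (k x)) ≡ 0# → All (λ x → k x ≡ 0) xs
  sumL-fromℕ≡0 xs k sum≡0 = allZero xs (fromℕ≡0 (trans (sym (sumL-fromℕ xs)) sum≡0))
    where
    fromℕ-+ : ∀ m n → fromℕ (m ℕ.+ n) ≡ fromℕ m + fromℕ n
    fromℕ-+ zero    n = sym (+-identityˡ _)
    fromℕ-+ (suc m) n = trans (cong (1# +_) (fromℕ-+ m n)) (sym (+-assoc _ _ _))
    sumL-fromℕ : ∀ xs → sumL xs (λ x → fromℕ (k x)) ≡ fromℕ (sum (map k xs))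
    sumL-fromℕ []       = refl
    sumL-fromℕ (x ∷ xs) = trans (cong (fromℕ (k x) +_) (sumL-fromℕ xs)) (sym (fromℕ-+ (k x) _))
    fromℕ≡0 : ∀ {m} → fromℕ m ≡ 0# → m ≡ 0
    fromℕ≡0 {zero}  _    = refl
    fromℕ≡0 {suc m} 1+m≡0 = ⊥-elim (charZero m 1+m≡0)
    allZero : ∀ xs → sum (map k xs) ≡ 0 → All (λ x → k x ≡ 0) xs
    allZero []       _      = []
    allZero (x ∷ xs) sum≡0′ = ℕ.m+n≡0⇒m≡0 (k x) sum≡0′ ∷ allZero xs (ℕ.m+n≡0⇒n≡0 (k x) sum≡0′)

  sameClass : ∀ {x y} → Dec (IsSquare x) → Dec (IsSquare y) → ℕ
  sameClass (yes _) (yes _) = 2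
  sameClass (no _)  (no _)  = 2
  sameClass _       _       = 0

  sameClass≡0 : ∀ {x y} (x? : Dec (IsSquare x)) (y? : Dec (IsSquare y)) → sameClass x? y? ≡ 0 → ¬ IsSquare y → IsSquare x
  sameClass≡0 (yes x□) _        _  _  = x□
  sameClass≡0 (no _)   (yes y□) _  y⊠ = ⊥-elim (y⊠ y□)
  sameClass≡0 (no _)   (no _)   () _

  fromℕ-sameClass : ∀ {x y} → x ≢ F.0# → y ≢ F.0# → (x? : Dec (IsSquare x)) (y? : Dec (IsSquare y)) →
                    fromℕ (sameClass x? y?) ≡ 1# + φ x * φ y
  fromℕ-sameClass x≢0 y≢0 (yes x□) (yes y□) = sym (cong (1# +_) (trans (cong₂ _*_ (φ-square x≢0 x□) (φ-square y≢0 y□)) (trans (*-identityˡ 1#) (sym (+-identityʳ 1#)))))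
  fromℕ-sameClass x≢0 y≢0 (yes x□) (no y⊠)  = sym (trans (cong (1# +_) (trans (cong₂ _*_ (φ-square x≢0 x□) (φ-nonSquare y≢0 y⊠)) (*-identityˡ _))) (-‿inverseʳ 1#))
  fromℕ-sameClass x≢0 y≢0 (no x⊠)  (yes y□) = sym (trans (cong (1# +_) (trans (cong₂ _*_ (φ-nonSquare x≢0 x⊠) (φ-square y≢0 y□)) (*-identityʳ _))) (-‿inverseʳ 1#))
  fromℕ-sameClass x≢0 y≢0 (no x⊠)  (no y⊠)  = sym (cong (1# +_) (trans (cong₂ _*_ (φ-nonSquare x≢0 x⊠) (φ-nonSquare y≢0 y⊠)) (trans -1*-1≡1 (sym (+-identityʳ 1#)))))

  -- n y² runs through nonsquares, so Σ_y φ(n y²) = -(q - 1); comparing with sumAll-square′ gives the claim.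
  sumAll-φ[n*w]*φ[w] : ∀ {n} → n ≢ F.0# → ¬ IsSquare n → sumAll (λ w → φ (n F.* w) * φ w) ≡ - sumUnits (λ _ → 1#)
  sumAll-φ[n*w]*φ[w] {n} n≢0 n⊠ = sym (begin
    - sumUnits (λ _ → 1#)
      ≡⟨ -‿distrib-sumL F.units _ ⟩
    sumUnits (λ _ → - 1#)
      ≡⟨ sumUnits-cong (λ y y≢0 → sym (φ-nonSquare (𝔽.*-≢0 n≢0 (𝔽.*-≢0 y≢0 y≢0)) (ny²⊠ y≢0))) ⟩
    sumUnits (λ y → φ (n F.* (y F.* y)))
      ≡⟨ sumUnits≡sumAll _ (trans (cong φ (trans (cong (n F.*_) (𝔽.zeroˡ F.0#)) (𝔽.zeroʳ n))) φ-0) ⟩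
    sumAll (λ y → φ (n F.* (y F.* y)))
      ≡⟨ sumAll-square′ (λ w → φ (n F.* w)) ⟩
    sumAll (λ w → φ (n F.* w)) + sumAll (λ w → φ (n F.* w) * φ w)
      ≡⟨ cong (_+ sumAll (λ w → φ (n F.* w) * φ w)) (trans (sumAll-dilate n≢0 φ) sumAll-φ) ⟩
    0# + sumAll (λ w → φ (n F.* w) * φ w)
      ≡⟨ +-identityˡ _ ⟩
    sumAll (λ w → φ (n F.* w) * φ w) ∎)
    where
    ny²⊠ : ∀ {y} → y ≢ F.0# → ¬ IsSquare (n F.* (y F.* y))
    ny²⊠ {y} y≢0 ny²□ = n⊠ (isSquare-÷ (𝔽.*-≢0 y≢0 y≢0) (isSquare y refl) (subst IsSquare (𝔽.*-comm n _) ny²□))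

  -- Σ_{w ≠ 0} (1 + φ(nw) φ(w)) = 0 by the previous lemma, and its terms are 0 or 2; in characteristic
  -- zero they all vanish, which at w = m says that n m is a square.
  nonSquare-* : ∀ {n m} → n ≢ F.0# → m ≢ F.0# → ¬ IsSquare n → ¬ IsSquare m → IsSquare (n F.* m)
  nonSquare-* {n} {m} n≢0 m≢0 n⊠ m⊠ =
    sameClass≡0 (isSquare? (n F.* m)) (isSquare? m) (All.lookup (sumL-fromℕ≡0 F.units classes Σclasses≡0) m∈units) m⊠
    where
    classes : F.Carrier → ℕ
    classes w = sameClass (isSquare? (n F.* w)) (isSquare? w)
    m∈units = ∈-filter⁺ (λ x → ¬? (x F.≟ F.0#)) (F.complete m) m≢0
    Σclasses≡0 : sumUnits (λ w → fromℕ (classes w)) ≡ 0#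
    Σclasses≡0 = begin
      sumUnits (λ w → fromℕ (classes w))
        ≡⟨ sumUnits-cong (λ w w≢0 → fromℕ-sameClass (𝔽.*-≢0 n≢0 w≢0) w≢0 (isSquare? (n F.* w)) (isSquare? w)) ⟩
      sumUnits (λ w → 1# + φ (n F.* w) * φ w)
        ≡⟨ sumL-+ F.units _ _ ⟩
      sumUnits (λ _ → 1#) + sumUnits (λ w → φ (n F.* w) * φ w)
        ≡⟨ cong (sumUnits (λ _ → 1#) +_) (sumUnits≡sumAll _ (trans (cong (φ (n F.* F.0#) *_) φ-0) (zeroʳ _))) ⟩
      sumUnits (λ _ → 1#) + sumAll (λ w → φ (n F.* w) * φ w)
        ≡⟨ cong (sumUnits (λ _ → 1#) +_) (sumAll-φ[n*w]*φ[w] n≢0 n⊠) ⟩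
      sumUnits (λ _ → 1#) + - sumUnits (λ _ → 1#)
        ≡⟨ -‿inverseʳ _ ⟩
      0# ∎

  φ-isMultChar : IsMultChar φ
  φ-isMultChar = record
    { at-0 = φ-0
    ; at-1 = φ-square 𝔽.1≢0 (isSquare F.1# (𝔽.*-identityˡ F.1#))
    ; hom  = λ x y → hom x y (x F.≟ F.0#) (y F.≟ F.0#) (isSquare? x) (isSquare? y)
    }
    where
    hom : ∀ x y → Dec (x ≡ F.0#) → Dec (y ≡ F.0#) → Dec (IsSquare x) → Dec (IsSquare y) → φ (x F.* y) ≡ φ x * φ y
    hom x y (yes refl) _ _ _ = trans (cong φ (𝔽.zeroˡ y)) (trans φ-0 (sym (trans (cong (_* φ y) φ-0) (zeroˡ _))))
    hom x y (no _) (yes refl) _ _ = trans (cong φ (𝔽.zeroʳ x)) (trans φ-0 (sym (trans (cong (φ x *_) φ-0) (zeroʳ _))))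
    hom x y (no x≢0) (no y≢0) (yes x□) (yes y□) =
      trans (φ-square xy≢0 (isSquare-* x□ y□)) (sym (trans (cong₂ _*_ (φ-square x≢0 x□) (φ-square y≢0 y□)) (*-identityˡ _)))
      where xy≢0 = 𝔽.*-≢0 x≢0 y≢0
    hom x y (no x≢0) (no y≢0) (yes x□) (no y⊠) =
      trans (φ-nonSquare xy≢0 (y⊠ ∘ isSquare-÷ x≢0 x□)) (sym (trans (cong₂ _*_ (φ-square x≢0 x□) (φ-nonSquare y≢0 y⊠)) (*-identityˡ _)))
      where xy≢0 = 𝔽.*-≢0 x≢0 y≢0
    hom x y (no x≢0) (no y≢0) (no x⊠) (yes y□) =
      trans (φ-nonSquare xy≢0 (x⊠ ∘ isSquare-÷ y≢0 y□ ∘ subst IsSquare (𝔽.*-comm x y))) (sym (trans (cong₂ _*_ (φ-nonSquare x≢0 x⊠) (φ-square y≢0 y□)) (*-identityʳ _)))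
      where xy≢0 = 𝔽.*-≢0 x≢0 y≢0
    hom x y (no x≢0) (no y≢0) (no x⊠) (no y⊠) =
      trans (φ-square xy≢0 (nonSquare-* x≢0 y≢0 x⊠ y⊠)) (sym (trans (cong₂ _*_ (φ-nonSquare x≢0 x⊠) (φ-nonSquare y≢0 y⊠)) -1*-1≡1))
      where xy≢0 = 𝔽.*-≢0 x≢0 y≢0

  module Duplication (ψ0≡1 : ψ F.0# ≡ 1#) where

    open Nondegenerate ψ0≡1

    jacobi : Ch → Ch → Carrier
    jacobi χ₁ χ₂ = sumAll (λ x → χ₁ x * χ₂ (F.1# F.- x))

    -- The coefficient of ψ(s) in G χ₁ * G χ₂.
    convolution : Ch → Ch → F.Carrier → Carrier
    convolution χ₁ χ₂ s = sumAll (λ x → χ₁ x * χ₂ (s F.- x))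

    convolution-0 : ∀ {χ₁ χ₂} → IsMultChar χ₂ → convolution χ₁ χ₂ F.0# ≡ χ₂ (F.- F.1#) * sumAll (χ₁ · χ₂)
    convolution-0 {χ₁} {χ₂} χ₂-mult = begin
      sumAll (λ x → χ₁ x * χ₂ (F.0# F.- x))         ≡⟨ sumL-cong F.elements (λ x → cong (λ w → χ₁ x * χ₂ w) (0-x≡-1*x x)) ⟩
      sumAll (λ x → χ₁ x * χ₂ ((F.- F.1#) F.* x))   ≡⟨ sumL-cong F.elements (λ x → trans (cong (χ₁ x *_) (IsMultChar.hom χ₂-mult _ _))
                                                        (solve 3 (λ a b c → a :* (b :* c) := b :* (a :* c)) refl (χ₁ x) _ (χ₂ x))) ⟩
      sumAll (λ x → χ₂ (F.- F.1#) * (χ₁ · χ₂) x)    ≡⟨ sym (*-distribˡ-sumL F.elements _ _) ⟩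
      χ₂ (F.- F.1#) * sumAll (χ₁ · χ₂)               ∎
      where
      0-x≡-1*x : ∀ x → F.0# F.- x ≡ (F.- F.1#) F.* x
      0-x≡-1*x x = trans (𝔽.solve 1 (λ x → 𝔽.con (ℤ.+ 0) 𝔽.:- x 𝔽.:= 𝔽.:- x) refl x)
        (trans (cong F.-_ (sym (𝔽.*-identityˡ x))) (𝔽.solve 2 (λ o x → 𝔽.:- (o 𝔽.:* x) 𝔽.:= 𝔽.:- o 𝔽.:* x) refl F.1# x))

    convolution-unit : ∀ {χ₁ χ₂} → IsMultChar χ₁ → IsMultChar χ₂ → ∀ {s} → s ≢ F.0# →
                       convolution χ₁ χ₂ s ≡ (χ₁ · χ₂) s * jacobi χ₁ χ₂
    convolution-unit {χ₁} {χ₂} χ₁-mult χ₂-mult {s} s≢0 = begin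
      sumAll (λ x → χ₁ x * χ₂ (s F.- x))                          ≡⟨ sym (sumAll-dilate s≢0 _) ⟩
      sumAll (λ x → χ₁ (s F.* x) * χ₂ (s F.- (s F.* x)))          ≡⟨ sumL-cong F.elements pointwise ⟩
      sumAll (λ x → (χ₁ · χ₂) s * (χ₁ x * χ₂ (F.1# F.- x)))       ≡⟨ sym (*-distribˡ-sumL F.elements _ _) ⟩
      (χ₁ · χ₂) s * jacobi χ₁ χ₂                                       ∎
      where
      s-sx≡s[1-x] : ∀ x → s F.- (s F.* x) ≡ s F.* (F.1# F.- x)
      s-sx≡s[1-x] x = trans (cong (F._- (s F.* x)) (sym (𝔽.*-identityʳ s)))
        (𝔽.solve 3 (λ s o x → s 𝔽.:* o 𝔽.:- s 𝔽.:* x 𝔽.:= s 𝔽.:* (o 𝔽.:- x)) refl s F.1# x)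
      pointwise : ∀ x → χ₁ (s F.* x) * χ₂ (s F.- (s F.* x)) ≡ (χ₁ · χ₂) s * (χ₁ x * χ₂ (F.1# F.- x))
      pointwise x = begin
        χ₁ (s F.* x) * χ₂ (s F.- (s F.* x))       ≡⟨ cong (λ w → χ₁ (s F.* x) * χ₂ w) (s-sx≡s[1-x] x) ⟩
        χ₁ (s F.* x) * χ₂ (s F.* (F.1# F.- x))    ≡⟨ cong₂ _*_ (IsMultChar.hom χ₁-mult s x) (IsMultChar.hom χ₂-mult s _) ⟩
        χ₁ s * χ₁ x * (χ₂ s * χ₂ (F.1# F.- x))    ≡⟨ solve 4 (λ a b c d → a :* b :* (c :* d) := a :* c :* (b :* d)) refl _ _ _ _ ⟩
        (χ₁ · χ₂) s * (χ₁ x * χ₂ (F.1# F.- x))    ∎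

    G*G≡jacobi*G : ∀ {χ₁ χ₂} → IsMultChar χ₁ → IsMultChar χ₂ →
              G χ₁ * G χ₂ ≡ jacobi χ₁ χ₂ * G (χ₁ · χ₂) + χ₂ (F.- F.1#) * sumAll (χ₁ · χ₂)
    G*G≡jacobi*G {χ₁} {χ₂} χ₁-mult χ₂-mult = begin
      G χ₁ * G χ₂
        ≡⟨ cong₂ _*_ (G≡sumAll χ₁-mult) (G≡sumAll χ₂-mult) ⟩
      sumAll (λ x → ψ x * χ₁ x) * sumAll (λ y → ψ y * χ₂ y)
        ≡⟨ *-distribʳ-sumL F.elements _ _ ⟩
      sumAll (λ x → ψ x * χ₁ x * sumAll (λ y → ψ y * χ₂ y))
        ≡⟨ sumL-cong F.elements (λ x → trans (*-distribˡ-sumL F.elements _ _) (sym (sumAll-translate (F.- x) _))) ⟩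
      sumAll (λ x → sumAll (λ s → ψ x * χ₁ x * (ψ (F.- x F.+ s) * χ₂ (F.- x F.+ s))))
        ≡⟨ sumL-cong F.elements (λ x → sumL-cong F.elements (pointwise x)) ⟩
      sumAll (λ x → sumAll (λ s → ψ s * (χ₁ x * χ₂ (s F.- x))))
        ≡⟨ sumL-swap F.elements F.elements _ ⟩
      sumAll (λ s → sumAll (λ x → ψ s * (χ₁ x * χ₂ (s F.- x))))
        ≡⟨ sumL-cong F.elements (λ s → sym (*-distribˡ-sumL F.elements _ _)) ⟩
      sumAll (λ s → ψ s * convolution χ₁ χ₂ s)
        ≡⟨ sumAll≡f0+sumUnits _ ⟩
      ψ F.0# * convolution χ₁ χ₂ F.0# + sumUnits (λ s → ψ s * convolution χ₁ χ₂ s)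
        ≡⟨ cong₂ _+_ (trans (cong (_* _) ψ0≡1) (trans (*-identityˡ _) (convolution-0 χ₂-mult)))
                     (trans (sumUnits-cong unitTerm) (sym (*-distribˡ-sumL F.units _ _))) ⟩
      χ₂ (F.- F.1#) * sumAll (χ₁ · χ₂) + jacobi χ₁ χ₂ * G (χ₁ · χ₂)
        ≡⟨ +-comm _ _ ⟩
      jacobi χ₁ χ₂ * G (χ₁ · χ₂) + χ₂ (F.- F.1#) * sumAll (χ₁ · χ₂) ∎
      where
      pointwise : ∀ x s → ψ x * χ₁ x * (ψ (F.- x F.+ s) * χ₂ (F.- x F.+ s)) ≡ ψ s * (χ₁ x * χ₂ (s F.- x))
      pointwise x s = begin
        ψ x * χ₁ x * (ψ (F.- x F.+ s) * χ₂ (F.- x F.+ s))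
          ≡⟨ solve 4 (λ a b c d → a :* b :* (c :* d) := (a :* c) :* (b :* d)) refl _ _ _ _ ⟩
        (ψ x * ψ (F.- x F.+ s)) * (χ₁ x * χ₂ (F.- x F.+ s))
          ≡⟨ cong₂ (λ u v → u * (χ₁ x * χ₂ v)) (trans (sym (ψ-hom _ _)) (cong ψ (𝔽.solve 2 (λ x s → x 𝔽.:+ (𝔽.:- x 𝔽.:+ s) 𝔽.:= s) refl x s))) (𝔽.+-comm _ _) ⟩
        ψ s * (χ₁ x * χ₂ (s F.- x)) ∎
      unitTerm : ∀ s → s ≢ F.0# → ψ s * convolution χ₁ χ₂ s ≡ jacobi χ₁ χ₂ * (ψ s * (χ₁ · χ₂) s)
      unitTerm s s≢0 = trans (cong (ψ s *_) (convolution-unit χ₁-mult χ₂-mult s≢0))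
        (solve 3 (λ a b c → a :* (b :* c) := c :* (a :* b)) refl (ψ s) ((χ₁ · χ₂) s) (jacobi χ₁ χ₂))

    private
      ½[1+_] : F.Carrier → F.Carrier
      ½[1+ y ] = ½ F.* (F.1# F.+ y)

      2*½≡1 : F.fromℕ 2 F.* ½ ≡ F.1#
      2*½≡1 = F.⁻¹-inverse _ 2≢0

      ½[1+2x-1]≡x : ∀ x → ½[1+ (F.fromℕ 2 F.* x) F.- F.1# ] ≡ x
      ½[1+2x-1]≡x x = begin
        ½ F.* (F.1# F.+ ((F.fromℕ 2 F.* x) F.- F.1#))  ≡⟨ 𝔽.solve 4 (λ h o t x → h 𝔽.:* (o 𝔽.:+ ((t 𝔽.:* x) 𝔽.:- o)) 𝔽.:= (t 𝔽.:* h) 𝔽.:* x) refl ½ F.1# (F.fromℕ 2) x ⟩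
        (F.fromℕ 2 F.* ½) F.* x                          ≡⟨ cong (F._* x) 2*½≡1 ⟩
        F.1# F.* x                                       ≡⟨ 𝔽.*-identityˡ x ⟩
        x                                                ∎

      2½[1+y]-1≡y : ∀ y → (F.fromℕ 2 F.* ½[1+ y ]) F.- F.1# ≡ y
      2½[1+y]-1≡y y = begin
        (F.fromℕ 2 F.* (½ F.* (F.1# F.+ y))) F.- F.1#  ≡⟨ cong (F._- F.1#) (𝔽.solve 3 (λ t h z → t 𝔽.:* (h 𝔽.:* z) 𝔽.:= (t 𝔽.:* h) 𝔽.:* z) refl (F.fromℕ 2) ½ _) ⟩
        ((F.fromℕ 2 F.* ½) F.* (F.1# F.+ y)) F.- F.1#  ≡⟨ cong (λ u → (u F.* (F.1# F.+ y)) F.- F.1#) 2*½≡1 ⟩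
        (F.1# F.* (F.1# F.+ y)) F.- F.1#                ≡⟨ cong (F._- F.1#) (𝔽.*-identityˡ _) ⟩
        (F.1# F.+ y) F.- F.1#                           ≡⟨ 𝔽.solve 2 (λ o y → (o 𝔽.:+ y) 𝔽.:- o 𝔽.:= y) refl F.1# y ⟩
        y                                               ∎

      -- The solver treats 1 as an atom, so x (1 - x) is first expanded until 1 and 2 occur only as 1 * 1 and 2 ½ * 1.
      ½[1+y]*[1-½[1+y]]≡¼[1-y²] : ∀ y → ½[1+ y ] F.* (F.1# F.- ½[1+ y ]) ≡ ¼ F.* (F.1# F.- (y F.* y))
      ½[1+y]*[1-½[1+y]]≡¼[1-y²] y = begin
        ½[1+ y ] F.* (F.1# F.- ½[1+ y ])
          ≡⟨ 𝔽.solve 3 (λ h o y → (h 𝔽.:* (o 𝔽.:+ y)) 𝔽.:* (o 𝔽.:- h 𝔽.:* (o 𝔽.:+ y)) 𝔽.:=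
                                   h 𝔽.:* h 𝔽.:* (o 𝔽.:* o 𝔽.:- y 𝔽.:* y) 𝔽.:+ h 𝔽.:* (o 𝔽.:+ y) 𝔽.:* (o 𝔽.:- (𝔽.con (ℤ.+ 2) 𝔽.:* h) 𝔽.:* o)) refl ½ F.1# y ⟩
        ½ F.* ½ F.* ((F.1# F.* F.1#) F.- (y F.* y)) F.+ ½ F.* (F.1# F.+ y) F.* (F.1# F.- ((F.fromℕ 2 F.* ½) F.* F.1#))
          ≡⟨ cong₂ (λ u v → ½ F.* ½ F.* (u F.- (y F.* y)) F.+ ½ F.* (F.1# F.+ y) F.* (F.1# F.- v))
               (𝔽.*-identityˡ F.1#) (trans (cong (F._* F.1#) 2*½≡1) (𝔽.*-identityˡ F.1#)) ⟩
        ½ F.* ½ F.* (F.1# F.- (y F.* y)) F.+ ½ F.* (F.1# F.+ y) F.* (F.1# F.- F.1#)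
          ≡⟨ 𝔽.solve 3 (λ h o y → h 𝔽.:* h 𝔽.:* (o 𝔽.:- y 𝔽.:* y) 𝔽.:+ h 𝔽.:* (o 𝔽.:+ y) 𝔽.:* (o 𝔽.:- o) 𝔽.:= h 𝔽.:* h 𝔽.:* (o 𝔽.:- y 𝔽.:* y)) refl ½ F.1# y ⟩
        ½ F.* ½ F.* (F.1# F.- (y F.* y))
          ≡⟨ cong (F._* (F.1# F.- (y F.* y))) (sym ¼≡½*½) ⟩
        ¼ F.* (F.1# F.- (y F.* y)) ∎

    -- Substituting x = (1 + y)/2 turns x (1 - x) into (1 - y²)/4.
    jacobi-self : ∀ {χ} → IsMultChar χ → jacobi χ χ ≡ χ ¼ * (sumAll χ + jacobi χ φ)
    jacobi-self {χ} χ-mult = begin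
      sumAll (λ x → χ x * χ (F.1# F.- x))
        ≡⟨ sumL-cong F.elements (λ x → sym (hom x _)) ⟩
      sumAll (λ x → χ (x F.* (F.1# F.- x)))
        ≡⟨ sym (sumAll-reindex ½[1+_] (λ x → (F.fromℕ 2 F.* x) F.- F.1#) ½[1+2x-1]≡x 2½[1+y]-1≡y _) ⟩
      sumAll (λ y → χ (½[1+ y ] F.* (F.1# F.- ½[1+ y ])))
        ≡⟨ sumL-cong F.elements (λ y → trans (cong χ (½[1+y]*[1-½[1+y]]≡¼[1-y²] y)) (hom _ _)) ⟩
      sumAll (λ y → χ ¼ * χ (F.1# F.- (y F.* y)))
        ≡⟨ sym (*-distribˡ-sumL F.elements _ _) ⟩
      χ ¼ * sumAll (λ y → χ (F.1# F.- (y F.* y)))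
        ≡⟨ cong (χ ¼ *_) (sumAll-square′ (λ w → χ (F.1# F.- w))) ⟩
      χ ¼ * (sumAll (λ w → χ (F.1# F.- w)) + sumAll (λ w → χ (F.1# F.- w) * φ w))
        ≡⟨ cong₂ (λ u v → χ ¼ * (u + v)) (sumAll-reflect χ) reflected ⟩
      χ ¼ * (sumAll χ + jacobi χ φ) ∎
      where
      open IsMultChar χ-mult
      reflected : sumAll (λ w → χ (F.1# F.- w) * φ w) ≡ jacobi χ φ
      reflected = trans
        (sumL-cong F.elements (λ w → cong (λ v → χ (F.1# F.- w) * φ v) (sym (𝔽.solve 2 (λ o w → o 𝔽.:- (o 𝔽.:- w) 𝔽.:= w) refl F.1# w))))
        (sumAll-reflect (λ x → χ x * φ (F.1# F.- x)))

    -- χ² trivial forces χ = ±1, hence χ = 1 on squares; χ(a) = -1 and (χ φ)(b) ≠ 1 then make χ(ab) = -1 on the square ab.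
    square-nonTrivial : ∀ {χ} → IsMultChar χ → NonTrivial χ → NonTrivial (χ · φ) → ¬ Trivial (χ · χ)
    square-nonTrivial {χ} χ-mult (a , a≢0 , χa≢1) (b , b≢0 , χbφb≢1) χ²-triv
      with x*x≡1⇒x≡1⊎x≡-1 (χ a) (χ²-triv a≢0)
    ... | inj₁ χa≡1  = χa≢1 χa≡1
    ... | inj₂ χa≡-1 = byClassOf (isSquare? b)
      where
      open IsMultChar χ-mult
      χ-square : ∀ {x} → x ≢ F.0# → IsSquare x → χ x ≡ 1#
      χ-square {x} x≢0 x□ with satisfied x□
      ... | y , y²≡x = trans (cong χ (sym y²≡x)) (trans (hom y y) (χ²-triv y≢0))
        where
        y≢0 : y ≢ F.0#
        y≢0 refl = x≢0 (trans (sym y²≡x) (𝔽.zeroˡ _))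
      byClassOf : Dec (IsSquare b) → ⊥
      byClassOf (yes b□) = χbφb≢1 (trans (cong₂ _*_ (χ-square b≢0 b□) (φ-square b≢0 b□)) (*-identityˡ 1#))
      byClassOf (no b⊠) with x*x≡1⇒x≡1⊎x≡-1 (χ b) (χ²-triv b≢0)
      ... | inj₂ χb≡-1 = χbφb≢1 (trans (cong₂ _*_ χb≡-1 (φ-nonSquare b≢0 b⊠)) -1*-1≡1)
      ... | inj₁ χb≡1  = -1≢1 (begin
        - 1#             ≡⟨ sym (*-identityʳ _) ⟩
        - 1# * 1#        ≡⟨ sym (cong₂ _*_ χa≡-1 χb≡1) ⟩
        χ a * χ b        ≡⟨ sym (hom a b) ⟩
        χ (a F.* b)      ≡⟨ χ-square (𝔽.*-≢0 a≢0 b≢0) (nonSquare-* a≢0 b≢0 (χa≢1 ∘ χ-square a≢0) b⊠) ⟩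
        1#               ∎)

    G-duplication-trivial : ∀ {χ} → Trivial χ → G χ * G (χ · φ) ≡ χ ¼ * G (χ · χ) * G φ
    G-duplication-trivial {χ} χ-triv = begin
      G χ * G (χ · φ)          ≡⟨ cong₂ _*_ (G-trivial χ-triv) (G-cong (λ x x≢0 → trans (cong (_* φ x) (χ-triv x≢0)) (*-identityˡ _))) ⟩
      - 1# * G φ               ≡⟨ cong (_* G φ) (sym (*-identityˡ (- 1#))) ⟩
      1# * - 1# * G φ          ≡⟨ cong₂ (λ u v → u * v * G φ) (sym (χ-triv ¼≢0)) (sym (G-trivial χ²-triv)) ⟩
      χ ¼ * G (χ · χ) * G φ    ∎
      where
      χ²-triv : Trivial (χ · χ)
      χ²-triv x≢0 = trans (cong₂ _*_ (χ-triv x≢0) (χ-triv x≢0)) (*-identityˡ 1#)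

    G-duplication-φ : ∀ {χ} → Trivial (χ · φ) → G χ * G (χ · φ) ≡ χ ¼ * G (χ · χ) * G φ
    G-duplication-φ {χ} χφ-triv = begin
      G χ * G (χ · φ)          ≡⟨ cong₂ _*_ (G-cong χ≗φ) (G-trivial χφ-triv) ⟩
      G φ * - 1#               ≡⟨ trans (*-comm _ _) (cong (_* G φ) (sym (*-identityˡ (- 1#)))) ⟩
      1# * - 1# * G φ          ≡⟨ cong₂ (λ u v → u * v * G φ) (sym χ¼≡1) (sym (G-trivial χ²-triv)) ⟩
      χ ¼ * G (χ · χ) * G φ    ∎
      where
      χ≗φ : ∀ x → x ≢ F.0# → χ x ≡ φ x
      χ≗φ x x≢0 = begin
        χ x                  ≡⟨ sym (*-identityʳ _) ⟩
        χ x * 1#             ≡⟨ cong (χ x *_) (sym (φ[x]*φ[x]≡1 x≢0)) ⟩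
        χ x * (φ x * φ x)    ≡⟨ sym (*-assoc _ _ _) ⟩
        (χ x * φ x) * φ x    ≡⟨ cong (_* φ x) (χφ-triv x≢0) ⟩
        1# * φ x             ≡⟨ *-identityˡ _ ⟩
        φ x                  ∎
      χ¼≡1 : χ ¼ ≡ 1#
      χ¼≡1 = trans (χ≗φ ¼ ¼≢0) (φ-square ¼≢0 (isSquare ½ (sym ¼≡½*½)))
      χ²-triv : Trivial (χ · χ)
      χ²-triv {x} x≢0 = trans (cong₂ _*_ (χ≗φ x x≢0) (χ≗φ x x≢0)) (φ[x]*φ[x]≡1 x≢0)

    -- Expand both G χ * G χ and G χ * G φ by Jacobi sums; all character sums Σ χ, Σ χ², Σ χφ vanish.
    G-duplication-generic : ∀ {χ} → IsMultChar χ → NonTrivial χ → NonTrivial (χ · φ) → NonTrivial (χ · χ) →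
                            G χ * G (χ · φ) ≡ χ ¼ * G (χ · χ) * G φ
    G-duplication-generic {χ} χ-mult (a , a≢0 , χa≢1) (b , b≢0 , χφb≢1) (c , c≢0 , χ²c≢1) =
      *-cancelˡ _ _ (G≢0 χ-mult) (begin
        G χ * (G χ * G (χ · φ))
          ≡⟨ sym (*-assoc _ _ _) ⟩
        G χ * G χ * G (χ · φ)
          ≡⟨ cong (_* G (χ · φ)) (trans (G*G≡jacobi*G χ-mult χ-mult) (cong (jacobi χ χ * G (χ · χ) +_) (vanish χχ-mult c≢0 χ²c≢1))) ⟩
        (jacobi χ χ * G (χ · χ) + 0#) * G (χ · φ)
          ≡⟨ cong (λ w → (w * G (χ · χ) + 0#) * G (χ · φ)) (trans (jacobi-self χ-mult) (cong (λ w → χ ¼ * (w + jacobi χ φ)) (MultChar.orthogonality χ-mult a≢0 χa≢1))) ⟩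
        (χ ¼ * (0# + jacobi χ φ) * G (χ · χ) + 0#) * G (χ · φ)
          ≡⟨ solve 4 (λ a j gg gf → (a :* (con (ℤ.+ 0) :+ j) :* gg :+ con (ℤ.+ 0)) :* gf := a :* gg :* (j :* gf :+ con (ℤ.+ 0))) refl (χ ¼) (jacobi χ φ) (G (χ · χ)) (G (χ · φ)) ⟩
        χ ¼ * G (χ · χ) * (jacobi χ φ * G (χ · φ) + 0#)
          ≡⟨ cong (λ w → χ ¼ * G (χ · χ) * (jacobi χ φ * G (χ · φ) + w)) (sym (vanish χφ-mult b≢0 χφb≢1)) ⟩
        χ ¼ * G (χ · χ) * (jacobi χ φ * G (χ · φ) + φ (F.- F.1#) * sumAll (χ · φ))
          ≡⟨ cong (χ ¼ * G (χ · χ) *_) (sym (G*G≡jacobi*G χ-mult φ-isMultChar)) ⟩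
        χ ¼ * G (χ · χ) * (G χ * G φ)
          ≡⟨ solve 4 (λ a b c d → a :* b :* (c :* d) := c :* (a :* b :* d)) refl (χ ¼) (G (χ · χ)) (G χ) (G φ) ⟩
        G χ * (χ ¼ * G (χ · χ) * G φ) ∎)
      where
      χχ-mult = ·-isMultChar χ-mult χ-mult
      χφ-mult = ·-isMultChar χ-mult φ-isMultChar
      G≢0 : ∀ {η} → IsMultChar η → G η ≢ 0#
      G≢0 η-mult Gη≡0 = g≢0 η-mult (trans (cong -_ Gη≡0) -0≡0)
      vanish : ∀ {η} → IsMultChar η → ∀ {a} → a ≢ F.0# → η a ≢ 1# → ∀ {k} → k * sumAll η ≡ 0#
      vanish η-mult a≢0 ηa≢1 = trans (cong (_ *_) (MultChar.orthogonality η-mult a≢0 ηa≢1)) (zeroʳ _)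

    G-duplication : ∀ {χ} → IsMultChar χ → G χ * G (χ · φ) ≡ χ ¼ * G (χ · χ) * G φ
    G-duplication {χ} χ-mult with trivial-or-nonTrivial χ χ-mult
    ... | inj₁ (_ , χ-triv) = G-duplication-trivial χ-triv
    ... | inj₂ (_ , χ-nontriv) with trivial-or-nonTrivial (χ · φ) (·-isMultChar χ-mult φ-isMultChar)
    ...   | inj₁ (_ , χφ-triv) = G-duplication-φ χφ-triv
    ...   | inj₂ (_ , χφ-nontriv) with trivial-or-nonTrivial (χ · χ) (·-isMultChar χ-mult χ-mult)
    ...     | inj₁ (_ , χ²-triv)    = ⊥-elim (square-nonTrivial χ-mult χ-nontriv χφ-nontriv χ²-triv)
    ...     | inj₂ (_ , χ²-nontriv) = G-duplication-generic χ-mult χ-nontriv χφ-nontriv χ²-nontriv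

    duplication : ∀ {χ} → IsMultChar χ → g χ * g (χ · φ) ≡ χ ¼ * g (χ · χ) * g φ
    duplication {χ} χ-mult = begin
      g χ * g (χ · φ)            ≡⟨ solve 2 (λ a b → :- a :* :- b := a :* b) refl (G χ) (G (χ · φ)) ⟩
      G χ * G (χ · φ)            ≡⟨ G-duplication χ-mult ⟩
      χ ¼ * G (χ · χ) * G φ      ≡⟨ solve 3 (λ a b c → a :* b :* c := a :* :- b :* :- c) refl (χ ¼) (G (χ · χ)) (G φ) ⟩
      χ ¼ * g (χ · χ) * g φ      ∎

module HypergeometricSums (F : FiniteField) (K : Field) (charZero : CharZero K)
                          (ψ : FiniteField.Carrier F → Field.Carrier K)
                          (ψ-isAddChar : Characters.IsNontrivAddChar F K ψ)
                          (chars : List (FiniteField.Carrier F → Field.Carrier K))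
                          (chars-isCharList : Characters.IsCharList F K chars) where

  open import Data.Nat using (ℕ; zero; suc)
  open import Data.Fin using (Fin; zero; suc)
  open import Relation.Binary.PropositionalEquality

  open FieldProperties K
  open GaussSums F K charZero ψ ψ-isAddChar chars hiding (module Nondegenerate)
  open Characters F K using (IsMultChar; module IsMultChar; module IsCharList)
  open ≡-Reasoning

  [1-q]⁻¹ : Carrier
  [1-q]⁻¹ = (1# - qK) ⁻¹

  -- Chosen so that hypF as bs l is definitionally [1-q]⁻¹ * Σ_ν coeff as bs ν * ν l.
  coeff : List Ch → List Ch → Ch → Carrier
  coeff as bs ν = prodL as (λ a → poch a ν) * (poch° ε ν * prodL bs (λ b → poch° b ν)) ⁻¹

  sumTuples-cong : ∀ n {f h : (Fin n → Ch) → Carrier} → (∀ ν → MultTuple n ν → f ν ≡ h ν) → sumTuples n f ≡ sumTuples n h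
  sumTuples-cong zero    f≗h = f≗h _ (λ ())
  sumTuples-cong (suc n) f≗h = sumL-congᴬ (IsCharList.all-chars chars-isCharList) (λ ν ν-mult →
    sumTuples-cong n (λ νs νs-mult → f≗h _ (λ { zero → ν-mult ; (suc i) → νs-mult i })))

  *-distribˡ-sumTuples : ∀ n c (f : (Fin n → Ch) → Carrier) → c * sumTuples n f ≡ sumTuples n (λ ν → c * f ν)
  *-distribˡ-sumTuples zero    c f = refl
  *-distribˡ-sumTuples (suc n) c f =
    trans (*-distribˡ-sumL chars c _) (sumL-cong chars (λ ν → *-distribˡ-sumTuples n c _))

  sumL-sumTuples : ∀ {A : Set} (xs : List A) n (f : A → (Fin n → Ch) → Carrier) →
                   sumL xs (λ a → sumTuples n (f a)) ≡ sumTuples n (λ ν → sumL xs (λ a → f a ν))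
  sumL-sumTuples xs zero    f = refl
  sumL-sumTuples xs (suc n) f = trans (sumL-swap xs chars _) (sumL-cong chars (λ ν → sumL-sumTuples xs n _))

  prodFin-sumL : ∀ n (k : Fin n → Ch → Carrier) →
                 prodFin n (λ i → sumL chars (k i)) ≡ sumTuples n (λ ν → prodFin n (λ i → k i (ν i)))
  prodFin-sumL zero    k = refl
  prodFin-sumL (suc n) k = begin
    sumL chars (k zero) * prodFin n (λ i → sumL chars (k (suc i)))
      ≡⟨ cong (sumL chars (k zero) *_) (prodFin-sumL n (λ i → k (suc i))) ⟩
    sumL chars (k zero) * sumTuples n (λ ν → prodFin n (λ i → k (suc i) (ν i)))
      ≡⟨ *-distribʳ-sumL chars _ (k zero) ⟩
    sumL chars (λ ν → k zero ν * sumTuples n (λ νs → prodFin n (λ i → k (suc i) (νs i))))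
      ≡⟨ sumL-cong chars (λ ν → *-distribˡ-sumTuples n (k zero ν) _) ⟩
    sumL chars (λ ν → sumTuples n (λ νs → k zero ν * prodFin n (λ i → k (suc i) (νs i)))) ∎

  *-sumTuples-scaled : ∀ n c (f : (Fin n → Ch) → Carrier) →
                       c * ([1-q]⁻¹ ^ n * sumTuples n f) ≡ [1-q]⁻¹ ^ n * sumTuples n (λ ν → c * f ν)
  *-sumTuples-scaled n c f = trans (solve 3 (λ c r s → c :* (r :* s) := r :* (c :* s)) refl c ([1-q]⁻¹ ^ n) _)
                                   (cong ([1-q]⁻¹ ^ n *_) (*-distribˡ-sumTuples n c f))

  sumL-sumTuples-scaled : ∀ {A : Set} (xs : List A) n (c : (Fin n → Ch) → Carrier) (f : A → (Fin n → Ch) → Carrier) →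
                          sumL xs (λ a → [1-q]⁻¹ ^ n * sumTuples n (λ ν → c ν * f a ν))
                            ≡ [1-q]⁻¹ ^ n * sumTuples n (λ ν → c ν * sumL xs (λ a → f a ν))
  sumL-sumTuples-scaled xs n c f = begin
    sumL xs (λ a → [1-q]⁻¹ ^ n * sumTuples n (λ ν → c ν * f a ν))
      ≡⟨ sym (*-distribˡ-sumL xs _ _) ⟩
    [1-q]⁻¹ ^ n * sumL xs (λ a → sumTuples n (λ ν → c ν * f a ν))
      ≡⟨ cong ([1-q]⁻¹ ^ n *_) (sumL-sumTuples xs n _) ⟩
    [1-q]⁻¹ ^ n * sumTuples n (λ ν → sumL xs (λ a → c ν * f a ν))
      ≡⟨ cong ([1-q]⁻¹ ^ n *_) (sumTuples-cong n (λ ν _ → sym (*-distribˡ-sumL xs (c ν) _))) ⟩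
    [1-q]⁻¹ ^ n * sumTuples n (λ ν → c ν * sumL xs (λ a → f a ν)) ∎

  coeffs : (n : ℕ) → (Fin n → List Ch) → (Fin n → List Ch) → (Fin n → Ch) → Carrier
  coeffs n as bs ν = prodFin n (λ i → coeff (as i) (bs i) (ν i))

  -- Multiplying out the product of the n sums over characters, then splitting ν_i (l_i x) = ν_i (l_i) ν_i (x).
  *-prodFin-hypF : ∀ n (as bs : Fin n → List Ch) (ls : Fin n → F.Carrier) x w →
                   w * prodFin n (λ i → hypF (as i) (bs i) (ls i F.* x))
                     ≡ [1-q]⁻¹ ^ n * sumTuples n (λ ν → coeffs n as bs ν * Λ n ν ls * (w * prodCh n ν x))
  *-prodFin-hypF n as bs ls x w = begin
    w * prodFin n (λ i → [1-q]⁻¹ * sumL chars (λ ν → c i ν * ν (ls i F.* x)))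
      ≡⟨ cong (w *_) (prodFin-* n _ _) ⟩
    w * (prodFin n (λ _ → [1-q]⁻¹) * prodFin n (λ i → sumL chars (λ ν → c i ν * ν (ls i F.* x))))
      ≡⟨ cong₂ (λ u v → w * (u * v)) (prodFin-const n [1-q]⁻¹) (prodFin-sumL n _) ⟩
    w * ([1-q]⁻¹ ^ n * sumTuples n (λ ν → prodFin n (λ i → c i (ν i) * ν i (ls i F.* x))))
      ≡⟨ *-sumTuples-scaled n w _ ⟩
    [1-q]⁻¹ ^ n * sumTuples n (λ ν → w * prodFin n (λ i → c i (ν i) * ν i (ls i F.* x)))
      ≡⟨ cong ([1-q]⁻¹ ^ n *_) (sumTuples-cong n split) ⟩
    [1-q]⁻¹ ^ n * sumTuples n (λ ν → coeffs n as bs ν * Λ n ν ls * (w * prodCh n ν x)) ∎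
    where
    c : Fin n → Ch → Carrier
    c i = coeff (as i) (bs i)
    split : ∀ ν → MultTuple n ν → w * prodFin n (λ i → c i (ν i) * ν i (ls i F.* x)) ≡ coeffs n as bs ν * Λ n ν ls * (w * prodCh n ν x)
    split ν ν-mult = begin
      w * prodFin n (λ i → c i (ν i) * ν i (ls i F.* x))
        ≡⟨ cong (w *_) (prodFin-cong n (λ i → trans (cong (c i (ν i) *_) (IsMultChar.hom (ν-mult i) (ls i) x)) (sym (*-assoc _ _ _)))) ⟩
      w * prodFin n (λ i → c i (ν i) * ν i (ls i) * ν i x)
        ≡⟨ cong (w *_) (trans (prodFin-* n _ _) (cong (_* prodCh n ν x) (prodFin-* n _ _))) ⟩
      w * (coeffs n as bs ν * Λ n ν ls * prodCh n ν x)
        ≡⟨ solve 4 (λ w a b p → w :* (a :* b :* p) := a :* b :* (w :* p)) refl w (coeffs n as bs ν) (Λ n ν ls) (prodCh n ν x) ⟩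
      coeffs n as bs ν * Λ n ν ls * (w * prodCh n ν x) ∎

  sumL-prodFin-hypF : ∀ {A : Set} (xs : List A) n (as bs : Fin n → List Ch) (ls : Fin n → F.Carrier) (w : A → Carrier) (h : A → F.Carrier) →
                      sumL xs (λ a → w a * prodFin n (λ i → hypF (as i) (bs i) (ls i F.* h a)))
                        ≡ [1-q]⁻¹ ^ n * sumTuples n (λ ν → coeffs n as bs ν * Λ n ν ls * sumL xs (λ a → w a * prodCh n ν (h a)))
  sumL-prodFin-hypF xs n as bs ls w h =
    trans (sumL-cong xs (λ a → *-prodFin-hypF n as bs ls (h a) (w a)))
          (sumL-sumTuples-scaled xs n (λ ν → coeffs n as bs ν * Λ n ν ls) (λ a ν → w a * prodCh n ν (h a)))

  *-lauricella : ∀ n c (f : (Fin n → Ch) → Carrier) →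
                 c * (((1# - qK) ^ n) ⁻¹ * sumTuples n f) ≡ [1-q]⁻¹ ^ n * sumTuples n (λ ν → c * f ν)
  *-lauricella n c f = trans (cong (λ z → c * (z * sumTuples n f)) (⁻¹-distrib-^ n 1-qK≢0)) (*-sumTuples-scaled n c f)

  prodFin-÷ : ∀ n {a e : Fin n → Carrier} → (∀ i → e i ≢ 0#) → prodFin n (λ i → a i * e i ⁻¹) ≡ prodFin n a * prodFin n e ⁻¹
  prodFin-÷ n {a} {e} e≢0 = trans (prodFin-* n a (λ i → e i ⁻¹)) (cong (prodFin n a *_) (prodFin-⁻¹ n e≢0))

  module Nondegenerate (ψ0≡1 : ψ F.0# ≡ 1#) where

    open GaussSums.Nondegenerate F K charZero ψ ψ-isAddChar chars ψ0≡1

    g*poch≡g : ∀ {α} ν → IsMultChar α → g α * poch α ν ≡ g (α · ν)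
    g*poch≡g {α} ν α-mult = begin
      g α * (g (α · ν) * g α ⁻¹)  ≡⟨ cong (g α *_) (*-comm _ _) ⟩
      g α * (g α ⁻¹ * g (α · ν))  ≡⟨ x*[x⁻¹*y]≡y _ (g≢0 α-mult) ⟩
      g (α · ν)                   ∎

    poch°⁻¹ : ∀ {α ν} → IsMultChar α → IsMultChar (α · ν) → poch° α ν ⁻¹ ≡ g° (α · ν) ⁻¹ * g° α
    poch°⁻¹ {α} {ν} α-mult αν-mult =
      trans (⁻¹-distrib-* (g°≢0 αν-mult) (⁻¹-≢0 (g°≢0 α-mult))) (cong (g° (α · ν) ⁻¹ *_) (⁻¹-involutive (g°≢0 α-mult)))

    conj-·-prodCh : ∀ γ {n} {ν : Fin n → Ch} → IsMultChar γ → MultTuple n ν → ∀ {t} → t ≢ F.0# →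
                    conj γ t * prodCh n ν (t F.⁻¹) ≡ conj (γ · prodCh n ν) t
    conj-·-prodCh γ {n} {ν} γ-mult ν-mult {t} t≢0 = begin
      conj γ t * prodFin n (λ i → ν i (t F.⁻¹))     ≡⟨ cong₂ _*_ (conj-unit γ t≢0) (prodFin-cong n (λ i → MultChar.⁻¹-homo (ν-mult i) t≢0)) ⟩
      γ t ⁻¹ * prodFin n (λ i → ν i t ⁻¹)           ≡⟨ cong (γ t ⁻¹ *_) (prodFin-⁻¹ n (λ i → MultChar.unit-≢0 (ν-mult i) t≢0)) ⟩
      γ t ⁻¹ * prodCh n ν t ⁻¹                      ≡⟨ sym (⁻¹-distrib-* (MultChar.unit-≢0 γ-mult t≢0) (prodFin-≢0 n (λ i → MultChar.unit-≢0 (ν-mult i) t≢0))) ⟩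
      (γ t * prodCh n ν t) ⁻¹                       ≡⟨ sym (conj-unit (γ · prodCh n ν) t≢0) ⟩
      conj (γ · prodCh n ν) t                       ∎

    module _ {n} {ν : Fin n → Ch} (ν-mult : MultTuple n ν) where

      E≢0 : E n ν ≢ 0#
      E≢0 = prodFin-≢0 n (λ i → poch°≢0 ε-isMultChar (·-isMultChar ε-isMultChar (ν-mult i)))

      denominators : ∀ {γ : Fin n → Ch} → MultTuple n γ →
                     prodFin n (λ i → poch° ε (ν i) * (poch° (γ i) (ν i) * 1#)) ≡ prodFin n (λ i → poch° (γ i) (ν i)) * E n ν
      denominators γ-mult = trans (prodFin-cong n (λ i → trans (cong (poch° ε (ν i) *_) (*-identityʳ _)) (*-comm _ _))) (prodFin-* n _ _)

      denominators≢0 : ∀ {γ : Fin n → Ch} → MultTuple n γ → ∀ i → poch° ε (ν i) * (poch° (γ i) (ν i) * 1#) ≢ 0#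
      denominators≢0 γ-mult i = *-≢0 (poch°≢0 ε-isMultChar (·-isMultChar ε-isMultChar (ν-mult i))) (*-≢0 (poch°≢0 (γ-mult i) (·-isMultChar (γ-mult i) (ν-mult i))) 1≢0)

      coeffs-1F1 : ∀ {β γ : Fin n → Ch} → MultTuple n γ →
                   coeffs n (λ i → β i ∷ []) (λ i → γ i ∷ []) ν
                     ≡ prodFin n (λ i → poch (β i) (ν i)) * (prodFin n (λ i → poch° (γ i) (ν i)) * E n ν) ⁻¹
      coeffs-1F1 γ-mult = trans (prodFin-÷ n (denominators≢0 γ-mult))
        (cong₂ (λ u v → u * v ⁻¹) (prodFin-cong n (λ i → *-identityʳ _)) (denominators γ-mult))

      coeffs-2F0 : ∀ {α β : Fin n → Ch} →
                   coeffs n (λ i → α i ∷ β i ∷ []) (λ _ → []) ν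
                     ≡ prodFin n (λ i → poch (α i) (ν i) * poch (β i) (ν i)) * E n ν ⁻¹
      coeffs-2F0 {α} = trans (prodFin-÷ n (λ i → *-≢0 (poch°≢0 ε-isMultChar (·-isMultChar ε-isMultChar (ν-mult i))) 1≢0))
        (cong₂ (λ u v → u * v ⁻¹) (prodFin-cong n (λ i → cong (poch (α i) (ν i) *_) (*-identityʳ _))) (prodFin-cong n (λ i → *-identityʳ _)))

      coeffs-0F1 : ∀ {γ : Fin n → Ch} → MultTuple n γ →
                   coeffs n (λ _ → []) (λ i → γ i ∷ []) ν ≡ (prodFin n (λ i → poch° (γ i) (ν i)) * E n ν) ⁻¹
      coeffs-0F1 γ-mult = trans (prodFin-cong n (λ i → *-identityˡ _))
        (trans (prodFin-⁻¹ n (denominators≢0 γ-mult)) (cong _⁻¹ (denominators γ-mult)))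

    lauricella-A : ∀ n α (β γ : Fin n → Ch) (ls : Fin n → F.Carrier) →
                   IsMultChar α → MultTuple n β → MultTuple n γ →
                   (- g α) * FA n α β γ ls
                     ≡ sumUnits (λ t → ψ t * α t * prodFin n (λ i → hypF (β i ∷ []) (γ i ∷ []) (ls i F.* t)))
    lauricella-A n α β γ ls α-mult β-mult γ-mult = begin
      (- g α) * FA n α β γ ls
        ≡⟨ *-lauricella n (- g α) _ ⟩
      [1-q]⁻¹ ^ n * sumTuples n (λ ν → - g α * summand ν)
        ≡⟨ cong ([1-q]⁻¹ ^ n *_) (sumTuples-cong n term) ⟩
      [1-q]⁻¹ ^ n * sumTuples n (λ ν → coeffs n as bs ν * Λ n ν ls * sumUnits (λ t → ψ t * α t * prodCh n ν t))
        ≡⟨ sym (sumL-prodFin-hypF F.units n as bs ls (λ t → ψ t * α t) (λ t → t)) ⟩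
      sumUnits (λ t → ψ t * α t * prodFin n (λ i → hypF (β i ∷ []) (γ i ∷ []) (ls i F.* t))) ∎
      where
      as bs : Fin n → List Ch
      as i = β i ∷ []
      bs i = γ i ∷ []
      summand : (Fin n → Ch) → Carrier
      summand ν = poch α (prodCh n ν) * prodFin n (λ i → poch (β i) (ν i))
                  * (prodFin n (λ i → poch° (γ i) (ν i)) * E n ν) ⁻¹ * Λ n ν ls
      term : ∀ ν → MultTuple n ν → - g α * summand ν ≡ coeffs n as bs ν * Λ n ν ls * sumUnits (λ t → ψ t * α t * prodCh n ν t)
      term ν ν-mult = begin
        - g α * (poch α P * B * D ⁻¹ * Λ n ν ls)
          ≡⟨ solve 5 (λ a p b d l → :- a :* (p :* b :* d :* l) := b :* d :* l :* :- (a :* p)) refl (g α) (poch α P) B (D ⁻¹) (Λ n ν ls) ⟩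
        B * D ⁻¹ * Λ n ν ls * - (g α * poch α P)
          ≡⟨ cong₂ (λ u v → u * Λ n ν ls * - v) (sym (coeffs-1F1 ν-mult γ-mult)) (g*poch≡g P α-mult) ⟩
        coeffs n as bs ν * Λ n ν ls * - g (α · P)
          ≡⟨ cong (coeffs n as bs ν * Λ n ν ls *_) (-‿involutive (G (α · P))) ⟩
        coeffs n as bs ν * Λ n ν ls * G (α · P)
          ≡⟨ cong (coeffs n as bs ν * Λ n ν ls *_) (sumL-cong F.units (λ t → sym (*-assoc _ _ _))) ⟩
        coeffs n as bs ν * Λ n ν ls * sumUnits (λ t → ψ t * α t * P t) ∎
        where
        P = prodCh n ν
        B = prodFin n (λ i → poch (β i) (ν i))
        D = prodFin n (λ i → poch° (γ i) (ν i)) * E n ν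

    lauricella-B : ∀ n (α β : Fin n → Ch) γ (ls : Fin n → F.Carrier) →
                   MultTuple n α → MultTuple n β → IsMultChar γ →
                   (- (qK * g° γ ⁻¹)) * FB n α β γ ls
                     ≡ sumUnits (λ t → ψ (F.- t) * conj γ t * prodFin n (λ i → hypF (α i ∷ β i ∷ []) [] (ls i F.* (t F.⁻¹))))
    lauricella-B n α β γ ls α-mult β-mult γ-mult = begin
      (- (qK * g° γ ⁻¹)) * FB n α β γ ls
        ≡⟨ *-lauricella n (- (qK * g° γ ⁻¹)) _ ⟩
      [1-q]⁻¹ ^ n * sumTuples n (λ ν → - (qK * g° γ ⁻¹) * summand ν)
        ≡⟨ cong ([1-q]⁻¹ ^ n *_) (sumTuples-cong n term) ⟩
      [1-q]⁻¹ ^ n * sumTuples n (λ ν → coeffs n as bs ν * Λ n ν ls * sumUnits (λ t → ψ (F.- t) * conj γ t * prodCh n ν (t F.⁻¹)))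
        ≡⟨ sym (sumL-prodFin-hypF F.units n as bs ls (λ t → ψ (F.- t) * conj γ t) F._⁻¹) ⟩
      sumUnits (λ t → ψ (F.- t) * conj γ t * prodFin n (λ i → hypF (α i ∷ β i ∷ []) [] (ls i F.* (t F.⁻¹)))) ∎
      where
      as bs : Fin n → List Ch
      as i = α i ∷ β i ∷ []
      bs i = []
      summand : (Fin n → Ch) → Carrier
      summand ν = prodFin n (λ i → poch (α i) (ν i) * poch (β i) (ν i))
                  * (poch° γ (prodCh n ν) * E n ν) ⁻¹ * Λ n ν ls
      term : ∀ ν → MultTuple n ν →
             - (qK * g° γ ⁻¹) * summand ν ≡ coeffs n as bs ν * Λ n ν ls * sumUnits (λ t → ψ (F.- t) * conj γ t * prodCh n ν (t F.⁻¹))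
      term ν ν-mult = begin
        - (qK * g° γ ⁻¹) * (A * (poch° γ P * E n ν) ⁻¹ * Λ n ν ls)
          ≡⟨ cong (λ w → - (qK * g° γ ⁻¹) * (A * w * Λ n ν ls))
               (trans (⁻¹-distrib-* (poch°≢0 γ-mult γP-mult) (E≢0 ν-mult)) (cong (_* E n ν ⁻¹) (poch°⁻¹ γ-mult γP-mult))) ⟩
        - (qK * g° γ ⁻¹) * (A * (g° (γ · P) ⁻¹ * g° γ * E n ν ⁻¹) * Λ n ν ls)
          ≡⟨ solve 7 (λ q a⁻¹ a b⁻¹ A e l → :- (q :* a⁻¹) :* (A :* (b⁻¹ :* a :* e) :* l) := (a :* a⁻¹) :* (A :* e :* l :* :- (q :* b⁻¹)))
               refl qK (g° γ ⁻¹) (g° γ) (g° (γ · P) ⁻¹) A (E n ν ⁻¹) (Λ n ν ls) ⟩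
        (g° γ * g° γ ⁻¹) * (A * E n ν ⁻¹ * Λ n ν ls * - (qK * g° (γ · P) ⁻¹))
          ≡⟨ [x*x⁻¹]*y≡y _ (g°≢0 γ-mult) ⟩
        A * E n ν ⁻¹ * Λ n ν ls * - (qK * g° (γ · P) ⁻¹)
          ≡⟨ cong₂ (λ u v → u * Λ n ν ls * v) (sym (coeffs-2F0 ν-mult)) (sym (Gbar≡-q/g° γP-mult)) ⟩
        coeffs n as bs ν * Λ n ν ls * Gbar (γ · P)
          ≡⟨ cong (coeffs n as bs ν * Λ n ν ls *_) (sumUnits-cong (λ t t≢0 →
               trans (cong (ψ (F.- t) *_) (sym (conj-·-prodCh γ γ-mult ν-mult t≢0))) (sym (*-assoc _ _ _)))) ⟩
        coeffs n as bs ν * Λ n ν ls * sumUnits (λ t → ψ (F.- t) * conj γ t * P (t F.⁻¹)) ∎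
        where
        P = prodCh n ν
        A = prodFin n (λ i → poch (α i) (ν i) * poch (β i) (ν i))
        γP-mult = ·-prodCh-isMultChar n ν γ-mult ν-mult

    prodCh-hom : ∀ {n} {ν : Fin n → Ch} → MultTuple n ν → ∀ x y → prodCh n ν (x F.* y) ≡ prodCh n ν x * prodCh n ν y
    prodCh-hom {n} {ν} ν-mult x y = trans (prodFin-cong n (λ i → IsMultChar.hom (ν-mult i) x y)) (prodFin-* n _ _)

    module OddCharacteristic (p : ℕ) (char-p : HasCharacteristic F p) (p≢2 : p ≢ 2) where

      open QuadraticCharacter F K charZero ψ ψ-isAddChar chars p char-p p≢2
        using (¼; ¼≢0; φ-isMultChar; module Duplication)
      open Duplication ψ0≡1 using (duplication)

      -- The finite-field analogue of (a)_n (a + ½)_n = 4^{-n} (2a)_{2n}.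
      poch-duplication : ∀ {α} P → IsMultChar α → IsMultChar (α · P) →
                         - g (α · α) * (poch α P * poch (α · φ) P) ≡ P ¼ * - g ((α · P) · (α · P))
      poch-duplication {α} P α-mult χ-mult = begin
        - g (α · α) * (g χ * g α ⁻¹ * (g ((α · φ) · P) * g (α · φ) ⁻¹))
          ≡⟨ solve 5 (λ a x a⁻¹ y b⁻¹ → :- a :* (x :* a⁻¹ :* (y :* b⁻¹)) := x :* y :* (a⁻¹ :* b⁻¹) :* :- a)
               refl (g (α · α)) (g χ) (g α ⁻¹) (g ((α · φ) · P)) (g (α · φ) ⁻¹) ⟩
        g χ * g ((α · φ) · P) * (g α ⁻¹ * g (α · φ) ⁻¹) * - g (α · α)
          ≡⟨ cong₂ (λ u v → u * v * - g (α · α))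
               (trans (cong (g χ *_) (g-cong (λ x _ → solve 3 (λ a f p → a :* f :* p := a :* p :* f) refl (α x) (φ x) (P x)))) (duplication χ-mult))
               (trans (sym (⁻¹-distrib-* (g≢0 α-mult) (g≢0 (·-isMultChar α-mult φ-isMultChar)))) (cong _⁻¹ (duplication α-mult))) ⟩
        (α ¼ * P ¼ * g (χ · χ) * g φ) * Q ⁻¹ * - g (α · α)
          ≡⟨ solve 6 (λ a q c f aa Q⁻¹ → (a :* q :* c :* f) :* Q⁻¹ :* :- aa := ((a :* aa :* f) :* Q⁻¹) :* (q :* :- c))
               refl (α ¼) (P ¼) (g (χ · χ)) (g φ) (g (α · α)) (Q ⁻¹) ⟩
        (Q * Q ⁻¹) * (P ¼ * - g (χ · χ))
          ≡⟨ [x*x⁻¹]*y≡y _ Q≢0 ⟩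
        P ¼ * - g (χ · χ) ∎
        where
        χ = α · P
        Q = α ¼ * g (α · α) * g φ
        Q≢0 : Q ≢ 0#
        Q≢0 = *-≢0 (*-≢0 (MultChar.unit-≢0 α-mult ¼≢0) (g≢0 (·-isMultChar α-mult α-mult))) (g≢0 φ-isMultChar)

      gaussSum-t²¼ : ∀ α {n} {ν : Fin n → Ch} → MultTuple n ν →
                     sumUnits (λ t → ψ t * (α · α) t * prodCh n ν (t F.* t F.* ¼)) ≡ prodCh n ν ¼ * - g ((α · prodCh n ν) · (α · prodCh n ν))
      gaussSum-t²¼ α {n} {ν} ν-mult = begin
        sumUnits (λ t → ψ t * (α · α) t * P (t F.* t F.* ¼))   ≡⟨ sumL-cong F.units pointwise ⟩
        sumUnits (λ t → P ¼ * (ψ t * (χ · χ) t))                ≡⟨ sym (*-distribˡ-sumL F.units (P ¼) _) ⟩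
        P ¼ * G (χ · χ)                                         ≡⟨ cong (P ¼ *_) (sym (-‿involutive _)) ⟩
        P ¼ * - g (χ · χ)                                       ∎
        where
        P = prodCh n ν
        χ = α · P
        pointwise : ∀ t → ψ t * (α · α) t * P (t F.* t F.* ¼) ≡ P ¼ * (ψ t * (χ · χ) t)
        pointwise t = begin
          ψ t * (α · α) t * P (t F.* t F.* ¼)     ≡⟨ cong (ψ t * (α · α) t *_) (trans (prodCh-hom ν-mult _ ¼) (cong (_* P ¼) (prodCh-hom ν-mult t t))) ⟩
          ψ t * (α t * α t) * (P t * P t * P ¼)   ≡⟨ solve 4 (λ s a x c → s :* (a :* a) :* (x :* x :* c) := c :* (s :* (a :* x :* (a :* x)))) refl (ψ t) (α t) (P t) (P ¼) ⟩
          P ¼ * (ψ t * (χ · χ) t)                 ∎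

      lauricella-C-quadratic : ∀ n α (β : Fin n → Ch) (ls : Fin n → F.Carrier) → IsMultChar α → MultTuple n β →
                               (- g (α · α)) * FC n α (α · φ) β ls
                                 ≡ sumUnits (λ t → ψ t * (α · α) t * prodFin n (λ i → hypF [] (β i ∷ []) (ls i F.* (t F.* t) F.* ¼)))
      lauricella-C-quadratic n α β ls α-mult β-mult = begin
        (- g (α · α)) * FC n α (α · φ) β ls
          ≡⟨ *-lauricella n (- g (α · α)) _ ⟩
        [1-q]⁻¹ ^ n * sumTuples n (λ ν → - g (α · α) * summand ν)
          ≡⟨ cong ([1-q]⁻¹ ^ n *_) (sumTuples-cong n term) ⟩
        [1-q]⁻¹ ^ n * sumTuples n (λ ν → coeffs n as bs ν * Λ n ν ls * sumUnits (λ t → ψ t * (α · α) t * prodCh n ν (t F.* t F.* ¼)))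
          ≡⟨ sym (sumL-prodFin-hypF F.units n as bs ls (λ t → ψ t * (α · α) t) (λ t → t F.* t F.* ¼)) ⟩
        sumUnits (λ t → ψ t * (α · α) t * prodFin n (λ i → hypF [] (β i ∷ []) (ls i F.* (t F.* t F.* ¼))))
          ≡⟨ sumL-cong F.units (λ t → cong (ψ t * (α · α) t *_) (prodFin-cong n (λ i → cong (hypF [] (β i ∷ [])) (sym (𝔽.*-assoc _ _ _))))) ⟩
        sumUnits (λ t → ψ t * (α · α) t * prodFin n (λ i → hypF [] (β i ∷ []) (ls i F.* (t F.* t) F.* ¼))) ∎
        where
        as bs : Fin n → List Ch
        as i = []
        bs i = β i ∷ []
        summand : (Fin n → Ch) → Carrier
        summand ν = poch α (prodCh n ν) * poch (α · φ) (prodCh n ν)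
                    * (prodFin n (λ i → poch° (β i) (ν i)) * E n ν) ⁻¹ * Λ n ν ls
        term : ∀ ν → MultTuple n ν →
               - g (α · α) * summand ν ≡ coeffs n as bs ν * Λ n ν ls * sumUnits (λ t → ψ t * (α · α) t * prodCh n ν (t F.* t F.* ¼))
        term ν ν-mult = begin
          - g (α · α) * (poch α P * poch (α · φ) P * D ⁻¹ * Λ n ν ls)
            ≡⟨ solve 5 (λ a x y d l → :- a :* (x :* y :* d :* l) := d :* l :* (:- a :* (x :* y))) refl (g (α · α)) (poch α P) (poch (α · φ) P) (D ⁻¹) (Λ n ν ls) ⟩
          D ⁻¹ * Λ n ν ls * (- g (α · α) * (poch α P * poch (α · φ) P))
            ≡⟨ cong₂ (λ u v → u * Λ n ν ls * v) (sym (coeffs-0F1 ν-mult β-mult)) (poch-duplication P α-mult (·-prodCh-isMultChar n ν α-mult ν-mult)) ⟩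
          coeffs n as bs ν * Λ n ν ls * (P ¼ * - g ((α · P) · (α · P)))
            ≡⟨ cong (coeffs n as bs ν * Λ n ν ls *_) (sym (gaussSum-t²¼ α ν-mult)) ⟩
          coeffs n as bs ν * Λ n ν ls * sumUnits (λ t → ψ t * (α · α) t * P (t F.* t F.* ¼)) ∎
          where
          P = prodCh n ν
          D = prodFin n (λ i → poch° (β i) (ν i)) * E n ν

    double-gaussSum : ∀ α β {n} {ν : Fin n → Ch} → MultTuple n ν →
                      sumUnits (λ s → sumUnits (λ t → ψ (s F.+ t) * α s * β t * prodCh n ν (s F.* t)))
                        ≡ g (α · prodCh n ν) * g (β · prodCh n ν)
    double-gaussSum α β {n} {ν} ν-mult = begin
      sumUnits (λ s → sumUnits (λ t → ψ (s F.+ t) * α s * β t * P (s F.* t)))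
        ≡⟨ sumL-cong F.units (λ s → sumL-cong F.units (λ t → separate s t)) ⟩
      sumUnits (λ s → sumUnits (λ t → ψ s * (α · P) s * (ψ t * (β · P) t)))
        ≡⟨ sumL-cong F.units (λ s → sym (*-distribˡ-sumL F.units _ _)) ⟩
      sumUnits (λ s → ψ s * (α · P) s * G (β · P))
        ≡⟨ sym (*-distribʳ-sumL F.units _ _) ⟩
      G (α · P) * G (β · P)
        ≡⟨ solve 2 (λ a b → a :* b := :- a :* :- b) refl (G (α · P)) (G (β · P)) ⟩
      g (α · P) * g (β · P) ∎
      where
      P = prodCh n ν
      separate : ∀ s t → ψ (s F.+ t) * α s * β t * P (s F.* t) ≡ ψ s * (α · P) s * (ψ t * (β · P) t)
      separate s t = begin
        ψ (s F.+ t) * α s * β t * P (s F.* t)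
          ≡⟨ cong₂ (λ u v → u * α s * β t * v) (ψ-hom s t) (prodCh-hom ν-mult s t) ⟩
        ψ s * ψ t * α s * β t * (P s * P t)
          ≡⟨ solve 6 (λ a b c d e f → a :* b :* c :* d :* (e :* f) := a :* (c :* e) :* (b :* (d :* f))) refl (ψ s) (ψ t) (α s) (β t) (P s) (P t) ⟩
        ψ s * (α · P) s * (ψ t * (β · P) t) ∎

    lauricella-C : ∀ n α β (γ : Fin n → Ch) (ls : Fin n → F.Carrier) → IsMultChar α → IsMultChar β → MultTuple n γ →
                   g α * g β * FC n α β γ ls
                     ≡ sumUnits (λ s → sumUnits (λ t → ψ (s F.+ t) * α s * β t * prodFin n (λ i → hypF [] (γ i ∷ []) (ls i F.* (s F.* t)))))
    lauricella-C n α β γ ls α-mult β-mult γ-mult = begin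
      g α * g β * FC n α β γ ls
        ≡⟨ *-lauricella n (g α * g β) _ ⟩
      [1-q]⁻¹ ^ n * sumTuples n (λ ν → g α * g β * summand ν)
        ≡⟨ cong ([1-q]⁻¹ ^ n *_) (sumTuples-cong n term) ⟩
      [1-q]⁻¹ ^ n * sumTuples n (λ ν → coeffs n as bs ν * Λ n ν ls * sumUnits (λ s → sumUnits (λ t → w s t * prodCh n ν (s F.* t))))
        ≡⟨ sym (sumL-sumTuples-scaled F.units n _ _) ⟩
      sumUnits (λ s → [1-q]⁻¹ ^ n * sumTuples n (λ ν → coeffs n as bs ν * Λ n ν ls * sumUnits (λ t → w s t * prodCh n ν (s F.* t))))
        ≡⟨ sym (sumL-cong F.units (λ s → sumL-prodFin-hypF F.units n as bs ls (w s) (s F.*_))) ⟩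
      sumUnits (λ s → sumUnits (λ t → ψ (s F.+ t) * α s * β t * prodFin n (λ i → hypF [] (γ i ∷ []) (ls i F.* (s F.* t))))) ∎
      where
      as bs : Fin n → List Ch
      as i = []
      bs i = γ i ∷ []
      w : F.Carrier → F.Carrier → Carrier
      w s t = ψ (s F.+ t) * α s * β t
      summand : (Fin n → Ch) → Carrier
      summand ν = poch α (prodCh n ν) * poch β (prodCh n ν)
                  * (prodFin n (λ i → poch° (γ i) (ν i)) * E n ν) ⁻¹ * Λ n ν ls
      term : ∀ ν → MultTuple n ν →
             g α * g β * summand ν ≡ coeffs n as bs ν * Λ n ν ls * sumUnits (λ s → sumUnits (λ t → w s t * prodCh n ν (s F.* t)))
      term ν ν-mult = begin
        g α * g β * (poch α P * poch β P * D ⁻¹ * Λ n ν ls)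
          ≡⟨ solve 6 (λ a b x y d l → a :* b :* (x :* y :* d :* l) := d :* l :* ((a :* x) :* (b :* y))) refl (g α) (g β) (poch α P) (poch β P) (D ⁻¹) (Λ n ν ls) ⟩
        D ⁻¹ * Λ n ν ls * ((g α * poch α P) * (g β * poch β P))
          ≡⟨ cong₂ (λ u v → u * Λ n ν ls * v) (sym (coeffs-0F1 ν-mult γ-mult)) (cong₂ _*_ (g*poch≡g P α-mult) (g*poch≡g P β-mult)) ⟩
        coeffs n as bs ν * Λ n ν ls * (g (α · P) * g (β · P))
          ≡⟨ cong (coeffs n as bs ν * Λ n ν ls *_) (sym (double-gaussSum α β ν-mult)) ⟩
        coeffs n as bs ν * Λ n ν ls * sumUnits (λ s → sumUnits (λ t → w s t * P (s F.* t))) ∎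
        where
        P = prodCh n ν
        D = prodFin n (λ i → poch° (γ i) (ν i)) * E n ν

  module Degenerate (ψ0≡0 : ψ F.0# ≡ 0#) where

    ψ≡0 : ∀ x → ψ x ≡ 0#
    ψ≡0 x = begin
      ψ x              ≡⟨ cong ψ (sym (𝔽.+-identityʳ x)) ⟩
      ψ (x F.+ F.0#)   ≡⟨ ψ-hom x F.0# ⟩
      ψ x * ψ F.0#     ≡⟨ cong (ψ x *_) ψ0≡0 ⟩
      ψ x * 0#         ≡⟨ zeroʳ _ ⟩
      0#               ∎

    x≡0⇒x*y≡0 : ∀ {x} y → x ≡ 0# → x * y ≡ 0#
    x≡0⇒x*y≡0 y refl = zeroˡ y

    sumUnits≡0 : ∀ {f} → (∀ x → f x ≡ 0#) → sumUnits f ≡ 0#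
    sumUnits≡0 f≡0 = trans (sumL-cong F.units f≡0) (sumL-zero F.units)

    g≡0 : ∀ η → g η ≡ 0#
    g≡0 η = trans (cong -_ (sumUnits≡0 (λ x → x≡0⇒x*y≡0 (η x) (ψ≡0 x)))) -0≡0

    -g≡0 : ∀ η → - g η ≡ 0#
    -g≡0 η = trans (cong -_ (g≡0 η)) -0≡0

    lauricella-A : ∀ n α (β γ : Fin n → Ch) (ls : Fin n → F.Carrier) →
                   (- g α) * FA n α β γ ls
                     ≡ sumUnits (λ t → ψ t * α t * prodFin n (λ i → hypF (β i ∷ []) (γ i ∷ []) (ls i F.* t)))
    lauricella-A n α β γ ls = trans (x≡0⇒x*y≡0 _ (-g≡0 α)) (sym (sumUnits≡0 (λ t → x≡0⇒x*y≡0 _ (x≡0⇒x*y≡0 _ (ψ≡0 t)))))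

    -- Every term of F_B contains the factor (α₀)_{ν₀}, a multiple of g(α₀ ν₀) = 0; this needs n ≥ 1.
    lauricella-B : ∀ m (α β : Fin (suc m) → Ch) γ (ls : Fin (suc m) → F.Carrier) →
                   (- (qK * g° γ ⁻¹)) * FB (suc m) α β γ ls
                     ≡ sumUnits (λ t → ψ (F.- t) * conj γ t * prodFin (suc m) (λ i → hypF (α i ∷ β i ∷ []) [] (ls i F.* (t F.⁻¹))))
    lauricella-B m α β γ ls = begin
      (- (qK * g° γ ⁻¹)) * FB (suc m) α β γ ls  ≡⟨ cong ((- (qK * g° γ ⁻¹)) *_) FB≡0 ⟩
      (- (qK * g° γ ⁻¹)) * 0#                   ≡⟨ zeroʳ _ ⟩
      0#                                        ≡⟨ sym (sumUnits≡0 (λ t → x≡0⇒x*y≡0 _ (x≡0⇒x*y≡0 _ (ψ≡0 (F.- t))))) ⟩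
      sumUnits (λ t → ψ (F.- t) * conj γ t * prodFin (suc m) (λ i → hypF (α i ∷ β i ∷ []) [] (ls i F.* (t F.⁻¹)))) ∎
      where
      sumTuples-zero : ∀ n → sumTuples n (λ _ → 0#) ≡ 0#
      sumTuples-zero zero    = refl
      sumTuples-zero (suc n) = trans (sumL-cong chars (λ _ → sumTuples-zero n)) (sumL-zero chars)
      termVanishes : ∀ ν → prodFin (suc m) (λ i → poch (α i) (ν i) * poch (β i) (ν i)) * (poch° γ (prodCh (suc m) ν) * E (suc m) ν) ⁻¹ * Λ (suc m) ν ls ≡ 0#
      termVanishes ν = x≡0⇒x*y≡0 _ (x≡0⇒x*y≡0 _ (x≡0⇒x*y≡0 _ (x≡0⇒x*y≡0 _ (x≡0⇒x*y≡0 _ (g≡0 (α zero · ν zero))))))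
      FB≡0 : FB (suc m) α β γ ls ≡ 0#
      FB≡0 = trans (cong (((1# - qK) ^ suc m) ⁻¹ *_) (trans (sumTuples-cong (suc m) (λ ν _ → termVanishes ν)) (sumTuples-zero (suc m))))
                   (zeroʳ _)

    lauricella-C-quadratic : ∀ n α (β : Fin n → Ch) (ls : Fin n → F.Carrier) →
                             (- g (α · α)) * FC n α (α · φ) β ls
                               ≡ sumUnits (λ t → ψ t * (α · α) t * prodFin n (λ i → hypF [] (β i ∷ []) (ls i F.* (t F.* t) F.* (F.fromℕ 4 F.⁻¹))))
    lauricella-C-quadratic n α β ls = trans (x≡0⇒x*y≡0 _ (-g≡0 (α · α))) (sym (sumUnits≡0 (λ t → x≡0⇒x*y≡0 _ (x≡0⇒x*y≡0 _ (ψ≡0 t)))))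

    lauricella-C : ∀ n α β (γ : Fin n → Ch) (ls : Fin n → F.Carrier) →
                   g α * g β * FC n α β γ ls
                     ≡ sumUnits (λ s → sumUnits (λ t → ψ (s F.+ t) * α s * β t * prodFin n (λ i → hypF [] (γ i ∷ []) (ls i F.* (s F.* t)))))
    lauricella-C n α β γ ls = trans (x≡0⇒x*y≡0 _ (x≡0⇒x*y≡0 _ (g≡0 α)))
      (sym (sumUnits≡0 (λ s → sumUnits≡0 (λ t → x≡0⇒x*y≡0 _ (x≡0⇒x*y≡0 _ (x≡0⇒x*y≡0 _ (ψ≡0 (s F.+ t))))))))

open import Data.Nat using (zero; suc)
open import Data.Product using (_,_)
open import Data.Sum using (inj₁; inj₂)

theorem3p1 :
  (F : FiniteField) (K : Field) → CharZero K → AlgClosed K →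
  (ψ : FiniteField.Carrier F → Field.Carrier K) →
  Characters.IsNontrivAddChar F K ψ →
  (chars : List (FiniteField.Carrier F → Field.Carrier K)) →
  Characters.IsCharList F K chars →
  (n : ℕ) → 1 ≤ n →
  let open Field K
      open Hyper F K ψ chars
      open Characters F K using (IsMultChar)
      module F = FiniteField F
  in
  -- (i)
  (∀ (α : Ch) (β γ : Fin n → Ch) (ls : Fin n → F.Carrier) →
     IsMultChar α → (∀ i → IsMultChar (β i)) → (∀ i → IsMultChar (γ i)) →
     (- g α) * FA n α β γ ls
       ≡ sumUnits (λ t → ψ t * α t
             * prodFin n (λ i → hypF (β i ∷ []) (γ i ∷ []) (ls i F.* t))))
  ×
  -- (ii)
  (∀ (α β : Fin n → Ch) (γ : Ch) (ls : Fin n → F.Carrier) →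
     (∀ i → IsMultChar (α i)) → (∀ i → IsMultChar (β i)) → IsMultChar γ →
     (- (qK * (g° γ) ⁻¹)) * FB n α β γ ls
       ≡ sumUnits (λ t → ψ (F.- t) * conj γ t
             * prodFin n (λ i → hypF (α i ∷ β i ∷ []) [] (ls i F.* (t F.⁻¹)))))
  ×
  -- (iii)
  (∀ (p : ℕ) → HasCharacteristic F p → p ≢ 2 →
   ∀ (α : Ch) (β : Fin n → Ch) (ls : Fin n → F.Carrier) →
     IsMultChar α → (∀ i → IsMultChar (β i)) →
     (- g (α · α)) * FC n α (α · φ) β ls
       ≡ sumUnits (λ t → ψ t * (α · α) t
             * prodFin n (λ i → hypF [] (β i ∷ [])
                 (ls i F.* (t F.* t) F.* (F.fromℕ 4 F.⁻¹)))))
  ×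
  -- (iv)
  (∀ (α β : Ch) (γ : Fin n → Ch) (ls : Fin n → F.Carrier) →
     IsMultChar α → IsMultChar β → (∀ i → IsMultChar (γ i)) →
     g α * g β * FC n α β γ ls
       ≡ sumUnits (λ s → sumUnits (λ t → ψ (s F.+ t) * α s * β t
             * prodFin n (λ i → hypF [] (γ i ∷ []) (ls i F.* (s F.* t))))))
theorem3p1 F K charZero _ ψ ψ-isAddChar chars chars-isCharList zero ()
theorem3p1 F K charZero _ ψ ψ-isAddChar chars chars-isCharList (suc m) _
  with GaussSums.ψ0≡0⊎ψ0≡1 F K charZero ψ ψ-isAddChar chars
... | inj₁ ψ0≡0 =
      (λ α β γ ls _ _ _ → lauricella-A (suc m) α β γ ls)
    , (λ α β γ ls _ _ _ → lauricella-B m α β γ ls)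
    , (λ _ _ _ α β ls _ _ → lauricella-C-quadratic (suc m) α β ls)
    , (λ α β γ ls _ _ _ → lauricella-C (suc m) α β γ ls)
  where open HypergeometricSums.Degenerate F K charZero ψ ψ-isAddChar chars chars-isCharList ψ0≡0
... | inj₂ ψ0≡1 =
      lauricella-A (suc m)
    , lauricella-B (suc m)
    , (λ p char-p p≢2 → OddCharacteristic.lauricella-C-quadratic p char-p p≢2 (suc m))
    , lauricella-C (suc m)
  where open HypergeometricSums.Nondegenerate F K charZero ψ ψ-isAddChar chars chars-isCharList ψ0≡1
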